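{- Let $\mu\subseteq\lambda$ be partitions such that the skew diagram $\lambda/\mu$ has $n$ cells, and let $N\geq n$. Then \[ P_{\lambda/\mu}(x_1,\ldots,x_N;t)=\sum_{S^*\in\mathrm{SYT}^*(\lambda/\mu)} \operatorname{sgn}(S^*)\,t^{\operatorname{tstat}(S^*)}\,F_{\operatorname{Asc}'(S^*)}(x_1,\ldots,x_N). \]
   Context: $t$ is an indeterminate. For a partition $\lambda$ and $\mu\subseteq\lambda$, the skew diagram is $\lambda/\mu=\{(i,j):1\le i\le \ell(\lambda),\ \mu_i<j\le\lambda_i\}$ (matrix coordinates, English convention); $\mu/(0)$ denotes the diagram of $\mu$. A semistandard tableau of shape $\lambda/\mu$ with entries in $[N]$ is a map $T:\lambda/\mu\to[N]$ weakly increasing along rows and strictly increasing down columns; $x^T=\prod_{c}x_{T(c)}$. A standard tableau is a bijection $\lambda/\mu\to[n]$ that is semistandard. For such $T$, a cell $(i,j)$ is special if $j>1$ and no cell $(u,j-1)\in\lambda/\mu$ has $T((u,j-1))=T((i,j))$; its weight is $\mathrm{wt}((i,j))=|\{(u,j-1)\in\lambda/\mu: u\ge i,\ T((u,j-1))<T((i,j))\}|+|\{(u,j-1)\in\mu/(0):u\ge i\}|$. Let $\mathrm{spec}(T)$ be the set of special cells. The skew Hall–Littlewood polynomial is $P_{\lambda/\mu}(x_1,\dots,x_N;t)=\sum_T \prod_{c\in\mathrm{spec}(T)}(1-t^{\mathrm{wt}(c)})\,x^T$, summed over semistandard tableaux $T$ of shape $\lambda/\mu$ with entries in $[N]$ (Macdonald's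 formula). A starred standard tableau is a pair $S^*=(S,E)$ with $S$ a standard tableau of shape $\lambda/\mu$ and $E\subseteq\mathrm{spec}(S)$ (i.e. $E$ is any set of cells not in column 1); $\mathrm{SYT}^*(\lambda/\mu)$ is the set of these, $\operatorname{sgn}(S^*)=(-1)^{|E|}$, $\operatorname{tstat}(S^*)=\sum_{c\in E}\mathrm{wt}(c)$. The ascent set $\operatorname{Asc}(S^*)$ is the set of $k<n$ such that either (a) $k+1$ appears in $S$ in a lower row than $k$, or (b) there are $u,i,j$ with $S((u,j-1))=k$, $S((i,j))=k+1$ and $(i,j)\in E$. For $T=\{t_1<\dots<t_m\}\subseteq[n-1]$, $\mathrm{comp}(T)=(t_1,t_2-t_1,\ldots,n-t_m)$, and $\operatorname{Asc}'(S^*)=\mathrm{comp}(\operatorname{Asc}(S^*))$. For a composition $\alpha$ of $n$ with $\mathrm{sub}(\alpha)=\{\alpha_1,\alpha_1+\alpha_2,\ldots,\alpha_1+\dots+\alpha_{\ell-1}\}$, the fundamental quasisymmetric polynomial is $F_\alpha(x_1,\ldots,x_N)=\sum x_{w_1}\cdots x_{w_n}$ over $1\le w_1\le\dots\le w_n\le N$ with $w_j<w_{j+1}$ for all $j\in\mathrm{sub}(\alpha)$. -}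

module Defs where

open import Data.Nat using (ℕ; zero; suc; _+_; _∸_; _≤_; _<_; _≡ᵇ_; _<ᵇ_; _≤ᵇ_)
open import Data.Bool using (Bool; true; false; _∧_; _∨_; not)
open import Data.List using (List; []; _∷_; _++_; map; foldr; concatMap; upTo; filterᵇ; length; zipWith; zip; [_])
open import Data.Bool.ListAction using (all; any)
open import Data.Nat.ListAction using (sum)
open import Data.List.Relation.Unary.All using (All)
open import Data.List.Relation.Unary.Linked using (Linked)
open import Data.Product using (_×_; _,_; proj₁; proj₂)
open import Algebra.Bundles using (CommutativeRing)
open import Level using (0ℓ)

-- 1-indexed lookup with default 0 : at xs i = x_i (and 0 if i = 0 or i > length)
at : List ℕ → ℕ → ℕ
at []       _             = 0
at (x ∷ xs) zero          = 0
at (x ∷ xs) (suc zero)    = x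
at (x ∷ xs) (suc (suc i)) = at xs (suc i)

oneTo : ℕ → List ℕ
oneTo m = map suc (upTo m)

between : ℕ → ℕ → List ℕ
between a b = map (λ k → a + suc k) (upTo (b ∸ a))

words : ℕ → ℕ → List (List ℕ)
words zero    N = [] ∷ []
words (suc n) N = concatMap (λ v → map (v ∷_) (words n N)) (oneTo N)

subsets : {A : Set} → List A → List (List A)
subsets []       = [] ∷ []
subsets (x ∷ xs) = subsets xs ++ map (x ∷_) (subsets xs)

count : {A : Set} → (A → Bool) → List A → ℕ
count p xs = length (filterᵇ p xs)

IsPartition : List ℕ → Set
IsPartition p = Linked (λ a b → b ≤ a) p × All (λ a → 0 < a) p

_⊆ₚ_ : List ℕ → List ℕ → Set
mu ⊆ₚ lam = (length mu ≤ length lam) × ((i : ℕ) → at mu i ≤ at lam i)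

-- cells in matrix coordinates (row i, column j), 1-indexed
Cell : Set
Cell = ℕ × ℕ

row col : Cell → ℕ
row = proj₁
col = proj₂

cells : List ℕ → List ℕ → List Cell
cells lam mu = concatMap (λ i → map (i ,_) (between (at mu i) (at lam i))) (oneTo (length lam))

-- a filling of the cells (listed as by `cells`) by the values vs, as a function on cells
-- (the value of a cell c is the value paired with the first occurrence of c; 0 off the diagram)
fill : List Cell → List ℕ → Cell → ℕ
fill cs vs c = go (zip cs vs)
  where
  go : List (Cell × ℕ) → ℕ
  go []                 = 0
  go (((i , j) , v) ∷ r) with (i ≡ᵇ row c) ∧ (j ≡ᵇ col c)
  ... | true  = v
  ... | false = go r

semistandard : List Cell → (Cell → ℕ) → ℕ → Bool
semistandard cs T N =
  all (λ c → (1 ≤ᵇ T c) ∧ (T c ≤ᵇ N)) cs ∧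
  all (λ c → all (λ d →
         (not ((row c ≡ᵇ row d) ∧ (col c <ᵇ col d)) ∨ (T c ≤ᵇ T d)) ∧
         (not ((col c ≡ᵇ col d) ∧ (row c <ᵇ row d)) ∨ (T c <ᵇ T d))) cs) cs

isBijection : List ℕ → ℕ → Bool
isBijection vs n = all (λ k → count (λ v → v ≡ᵇ k) vs ≡ᵇ 1) (oneTo n)

special : List Cell → (Cell → ℕ) → Cell → Bool
special cs T c =
  (1 <ᵇ col c) ∧ not (any (λ d → (col d ≡ᵇ col c ∸ 1) ∧ (T d ≡ᵇ T c)) cs)

wt : List ℕ → List Cell → (Cell → ℕ) → Cell → ℕ
wt mu cs T c =
  count (λ d → (col d ≡ᵇ col c ∸ 1) ∧ (row c ≤ᵇ row d) ∧ (T d <ᵇ T c)) cs +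
  count (λ d → (col d ≡ᵇ col c ∸ 1) ∧ (row c ≤ᵇ row d)) (cells mu [])

-- ascent set of a starred standard tableau (S, E), as an increasing list ⊆ [n-1]
asc : List Cell → (Cell → ℕ) → List Cell → ℕ → List ℕ
asc cs S E n = filterᵇ isAsc (oneTo (n ∸ 1))
  where
  isAsc : ℕ → Bool
  isAsc k =
    any (λ c → any (λ d → (S c ≡ᵇ k) ∧ (S d ≡ᵇ suc k) ∧ (row c <ᵇ row d)) cs) cs ∨
    any (λ d → any (λ e → (S d ≡ᵇ k) ∧ (S e ≡ᵇ suc k) ∧ (col d ≡ᵇ col e ∸ 1)) E) cs

comp : ℕ → List ℕ → List ℕ
comp n ts = zipWith _∸_ (ts ++ [ n ]) (0 ∷ ts)

sub : List ℕ → List ℕ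
sub []           = []
sub (a ∷ [])     = []
sub (a ∷ b ∷ r)  = a ∷ map (a +_) (sub (b ∷ r))

-- The two sides, evaluated in an arbitrary commutative ring R
-- (t ↦ t, x_k ↦ x k for k ∈ [N]).

module Eval (R : CommutativeRing 0ℓ 0ℓ) where
  open CommutativeRing R renaming (_+_ to _+R_; _*_ to _*R_)

  pow : Carrier → ℕ → Carrier
  pow a zero    = 1#
  pow a (suc k) = a *R pow a k

  Σ' : List Carrier → Carrier
  Σ' = foldr _+R_ 0#

  Π' : List Carrier → Carrier
  Π' = foldr _*R_ 1#

  mono : (ℕ → Carrier) → List ℕ → Carrier
  mono x w = Π' (map x w)

  F : List ℕ → ℕ → (ℕ → Carrier) → Carrier
  F α N x = Σ' (map (mono x) (filterᵇ ok (words n N)))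
    where
    n = sum α
    ok : List ℕ → Bool
    ok w = all (λ j → at w j ≤ᵇ at w (suc j)) (oneTo (n ∸ 1)) ∧
           all (λ j → at w j <ᵇ at w (suc j)) (sub α)

  -- skew Hall–Littlewood polynomial P_{λ/μ}(x₁,…,x_N; t) via Macdonald's formula
  HL : List ℕ → List ℕ → ℕ → Carrier → (ℕ → Carrier) → Carrier
  HL lam mu N t x =
    Σ' (map term (filterᵇ (λ vs → semistandard cs (fill cs vs) N) (words (length cs) N)))
    where
    cs = cells lam mu
    term : List ℕ → Carrier
    term vs = Π' (map (λ c → 1# +R (- pow t (wt mu cs T c))) (filterᵇ (special cs T) cs)) *R mono x vs
      where T = fill cs vs

  -- standard tableaux of shape λ/μ, as value lists aligned with `cells λ μ`
  SYT : List ℕ → List ℕ → List (List ℕ)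
  SYT lam mu = filterᵇ (λ vs → semistandard cs (fill cs vs) n ∧ isBijection vs n) (words n n)
    where
    cs = cells lam mu
    n  = length cs

  RHS : List ℕ → List ℕ → ℕ → Carrier → (ℕ → Carrier) → Carrier
  RHS lam mu N t x = Σ' (map termS (SYT lam mu))
    where
    cs = cells lam mu
    n  = length cs
    termS : List ℕ → Carrier
    termS vs = Σ' (map termE (subsets (filterᵇ (special cs S) cs)))
      where
      S = fill cs vs
      termE : List Cell → Carrier
      termE E = pow (- 1#) (length E) *R pow t (sum (map (wt mu cs S) E)) *R
                F (comp n (asc cs S E n)) N x

-- Expanding ∏(1 − t^wt) turns the left-hand side into a sum over pairs (T, E) of a semistandard
-- filling T of λ/μ with entries in [N] and a set E of special cells of T, while expanding each
-- F_α turns the right-hand side into a sum over triples (S, E, w) of a standard tableau S, a set E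
-- of cells outside the first column, and a word w ∈ [N]ⁿ that increases weakly, and strictly at
-- every ascent of (S, E). Standardisation matches the two: number the cells of T in increasing
-- order of entry, equal entries from left to right, to get S, and read T along S to get w, so that
-- T = w ∘ S. Cells with equal entries are read from left to right and never share a column, so w
-- increases strictly wherever S steps to a lower row; the strictness demanded at a starred ascent
-- into e ∈ E says precisely that the entry of T left of e differs from T e, i.e. that e is special
-- for T. The weights of the cells of E, and hence signs, powers of t and monomials, agree.
-- Conversely w ∘ S is semistandard and standardises back to S, which uses that a skew shape
-- contains (row c, col d) whenever c lies above and weakly left of d.

module Submission where

open import Algebra.Bundles using (CommutativeRing)
import Algebra.Properties.CommutativeSemigroup as CommutativeSemigroupProperties
import Algebra.Properties.Ring as RingProperties
open import Data.Bool using (Bool; true; false; _∧_; _∨_; not; if_then_else_; T?)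
open import Data.Bool.ListAction using (all; any)
open import Data.Bool.Properties using (T-≡; ¬-not)
open import Data.Empty using (⊥)
open import Data.List using (List; []; _∷_; _++_; [_]; map; filterᵇ; length; concatMap; upTo; zipWith)
open import Data.List.Membership.Propositional using (_∈_)
open import Data.List.Membership.Propositional.Properties
  using (∈-map⁺; ∈-map⁻; ∈-++⁻; ∈-concatMap⁺; ∈-concatMap⁻; ∈-filter⁺; ∈-filter⁻; ∈-upTo⁺; ∈-upTo⁻; ∈-∃++)
open import Data.List.Properties
  using ( length-map; length-upTo; length-++; length-filter; map-∘; map-id; map-upTo; map-cong-local
        ; filter-++; filter-none; ++-identityʳ )
open import Data.List.Relation.Binary.Permutation.Propositional using (_↭_; prep; ↭-trans; ↭-sym; ↭-refl; ↭⇒↭ₛ′)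
open import Data.List.Relation.Binary.Permutation.Propositional.Properties using (shift) renaming (map⁺ to ↭-map⁺)
import Data.List.Relation.Binary.Permutation.Setoid.Properties as PermutationProperties
open import Data.List.Relation.Unary.All as All using (All; []; _∷_)
import Data.List.Relation.Unary.All.Properties as AllProperties
open import Data.List.Relation.Unary.AllPairs using ([]; _∷_)
open import Data.List.Relation.Unary.Any as Any using (Any; here; there)
open import Data.List.Relation.Unary.Linked using (Linked; _∷_)
open import Data.List.Relation.Unary.Unique.Propositional using (Unique)
import Data.List.Relation.Unary.Unique.Propositional.Properties as Unique
open import Data.Nat using (ℕ; zero; suc; _+_; _∸_; _≤_; _<_; z≤n; s≤s; _≡ᵇ_; _<ᵇ_; _≤ᵇ_; _≟_)
open import Data.Nat.ListAction using (sum)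
open import Data.Nat.Properties
  using ( _≤?_; module ≤-Reasoning; suc-injective; ≡ᵇ⇒≡; ≡⇒≡ᵇ; <ᵇ⇒<; <⇒<ᵇ; ≤ᵇ⇒≤; ≤⇒≤ᵇ
        ; ≤-refl; ≤-reflexive; ≤-trans; ≤-antisym; ≤-pred; <-irrefl; <-asym; <-trans; <-cmp; ≤-<-trans; <-≤-trans
        ; <⇒≤; <⇒≢; <⇒≱; ≤⇒≯; ≰⇒>; ≤∧≢⇒<; m≤n⇒m<n∨m≡n; n≮0; n≤1+n; n<1+n; m≤n⇒m≤1+n; m≤m+n; m≤n+m; m<m+n
        ; +-assoc; +-comm; +-identityʳ; +-suc; +-cancelˡ-≡; +-cancelʳ-≡; +-commutativeSemigroup
        ; +-mono-≤; +-monoˡ-≤; +-monoʳ-≤; +-mono-≤-<; m+[n∸m]≡n; m∸n+n≡m; m≤n⇒∃[o]m+o≡n; m∸n≢0⇒n<m; ∸-monoˡ-< )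
open import Data.Product using (_×_; _,_; proj₁; proj₂; ∃-syntax)
open import Data.Product.Properties using (≡-dec)
open import Data.Sum using (_⊎_; inj₁; inj₂)
open import Function using (_∘_; Equivalence)
open import Level using (0ℓ)
open import Relation.Binary using (Tri; tri<; tri≈; tri>)
open import Relation.Binary.PropositionalEquality
  using (_≡_; _≢_; refl; sym; trans; cong; cong₂; subst; subst₂; module ≡-Reasoning)
open import Relation.Nullary using (¬_; Dec; yes; no)
open import Relation.Nullary.Negation using (contradiction)

open import Defs

open CommutativeSemigroupProperties +-commutativeSemigroup using ()
  renaming (interchange to +-interchange; x∙yz≈y∙xz to +-comm-middle)

T⇒≡true : ∀ {b} → Data.Bool.T b → b ≡ true
T⇒≡true = Equivalence.to T-≡

≡true⇒T : ∀ {b} → b ≡ true → Data.Bool.T b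
≡true⇒T = Equivalence.from T-≡

≢true⇒≡false : ∀ {b} → b ≢ true → b ≡ false
≢true⇒≡false = ¬-not

bool-ext : ∀ a b → (a ≡ true → b ≡ true) → (b ≡ true → a ≡ true) → a ≡ b
bool-ext false false _ _ = refl
bool-ext false true  _ g = g refl
bool-ext true  false f _ = sym (f refl)
bool-ext true  true  _ _ = refl

∧-true⁻ : ∀ {a b} → (a ∧ b) ≡ true → a ≡ true × b ≡ true
∧-true⁻ {true} {true} _ = refl , refl

∧-true⁺ : ∀ {a b} → a ≡ true → b ≡ true → (a ∧ b) ≡ true
∧-true⁺ refl refl = refl

∨-true⁻ : ∀ {a b} → (a ∨ b) ≡ true → a ≡ true ⊎ b ≡ true
∨-true⁻ {true}  _ = inj₁ refl
∨-true⁻ {false} h = inj₂ h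

∨-trueˡ : ∀ {a} b → a ≡ true → (a ∨ b) ≡ true
∨-trueˡ b refl = refl

∨-trueʳ : ∀ a {b} → b ≡ true → (a ∨ b) ≡ true
∨-trueʳ false h = h
∨-trueʳ true  _ = refl

⇒-true⁻ : ∀ {a b} → (not a ∨ b) ≡ true → a ≡ true → b ≡ true
⇒-true⁻ {true} h refl = h

⇒-true⁺ : ∀ a b → (a ≡ true → b ≡ true) → (not a ∨ b) ≡ true
⇒-true⁺ false _ _ = refl
⇒-true⁺ true  _ h = h refl

≡ᵇ-true⇒≡ : ∀ m n → (m ≡ᵇ n) ≡ true → m ≡ n
≡ᵇ-true⇒≡ m n = ≡ᵇ⇒≡ m n ∘ ≡true⇒T

≡⇒≡ᵇ-true : ∀ m n → m ≡ n → (m ≡ᵇ n) ≡ true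
≡⇒≡ᵇ-true m n = T⇒≡true ∘ ≡⇒≡ᵇ m n

≢⇒≡ᵇ-false : ∀ m n → m ≢ n → (m ≡ᵇ n) ≡ false
≢⇒≡ᵇ-false m n m≢n = ≢true⇒≡false (m≢n ∘ ≡ᵇ-true⇒≡ m n)

<ᵇ-true⇒< : ∀ m n → (m <ᵇ n) ≡ true → m < n
<ᵇ-true⇒< m n = <ᵇ⇒< m n ∘ ≡true⇒T

<⇒<ᵇ-true : ∀ {m n} → m < n → (m <ᵇ n) ≡ true
<⇒<ᵇ-true = T⇒≡true ∘ <⇒<ᵇ

≥⇒<ᵇ-false : ∀ {m n} → n ≤ m → (m <ᵇ n) ≡ false
≥⇒<ᵇ-false n≤m = ≢true⇒≡false (≤⇒≯ n≤m ∘ <ᵇ-true⇒< _ _)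

≤ᵇ-true⇒≤ : ∀ m n → (m ≤ᵇ n) ≡ true → m ≤ n
≤ᵇ-true⇒≤ m n = ≤ᵇ⇒≤ m n ∘ ≡true⇒T

≤⇒≤ᵇ-true : ∀ {m n} → m ≤ n → (m ≤ᵇ n) ≡ true
≤⇒≤ᵇ-true = T⇒≡true ∘ ≤⇒≤ᵇ

module _ {A : Set} (p : A → Bool) where

  all-true⁻ : ∀ xs → all p xs ≡ true → ∀ {a} → a ∈ xs → p a ≡ true
  all-true⁻ (x ∷ xs) h (here refl) with p x | h
  ... | true | _ = refl
  all-true⁻ (x ∷ xs) h (there a∈) with p x | h
  ... | true | h′ = all-true⁻ xs h′ a∈

  all-true⁺ : ∀ xs → (∀ {a} → a ∈ xs → p a ≡ true) → all p xs ≡ true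
  all-true⁺ []       _ = refl
  all-true⁺ (x ∷ xs) h rewrite h (here refl) = all-true⁺ xs (h ∘ there)

  any-true⁻ : ∀ xs → any p xs ≡ true → ∃[ a ] (a ∈ xs × p a ≡ true)
  any-true⁻ (x ∷ xs) h with p x in px
  ... | true  = x , here refl , px
  ... | false = let a , a∈ , pa = any-true⁻ xs h in a , there a∈ , pa

  any-true⁺ : ∀ xs {a} → a ∈ xs → p a ≡ true → any p xs ≡ true
  any-true⁺ (x ∷ xs) (here refl) pa rewrite pa = refl
  any-true⁺ (x ∷ xs) (there a∈) pa with p x
  ... | true  = refl
  ... | false = any-true⁺ xs a∈ pa

  any-false⁺ : ∀ xs → (∀ {a} → a ∈ xs → p a ≡ false) → any p xs ≡ false
  any-false⁺ []       _ = refl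
  any-false⁺ (x ∷ xs) h rewrite h (here refl) = any-false⁺ xs (h ∘ there)

  ∈-filterᵇ⁻ : ∀ {xs a} → a ∈ filterᵇ p xs → a ∈ xs × p a ≡ true
  ∈-filterᵇ⁻ a∈ = let a∈xs , pa = ∈-filter⁻ (T? ∘ p) a∈ in a∈xs , T⇒≡true pa

  ∈-filterᵇ⁺ : ∀ {xs a} → a ∈ xs → p a ≡ true → a ∈ filterᵇ p xs
  ∈-filterᵇ⁺ a∈ pa = ∈-filter⁺ (T? ∘ p) a∈ (≡true⇒T pa)

indicator : Bool → ℕ
indicator true  = 1
indicator false = 0

indicator-mono : ∀ a b → (a ≡ true → b ≡ true) → indicator a ≤ indicator b
indicator-mono false _ _ = z≤n
indicator-mono true  b f rewrite f refl = ≤-refl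

module _ {A : Set} (p : A → Bool) where

  count-∷ : ∀ x xs → count p (x ∷ xs) ≡ indicator (p x) + count p xs
  count-∷ x xs with p x
  ... | true  = refl
  ... | false = refl

  count-++ : ∀ xs ys → count p (xs ++ ys) ≡ count p xs + count p ys
  count-++ xs ys = trans (cong length (filter-++ (T? ∘ p) xs ys)) (length-++ (filterᵇ p xs))

  count≤length : ∀ xs → count p xs ≤ length xs
  count≤length xs = length-filter (T? ∘ p) xs

  count<length : ∀ xs {a} → a ∈ xs → p a ≡ false → count p xs < length xs
  count<length (x ∷ xs) (here refl) pa rewrite count-∷ x xs | pa = s≤s (count≤length xs)
  count<length (x ∷ xs) (there a∈) pa rewrite count-∷ x xs with p x
  ... | true  = s≤s (count<length xs a∈ pa)
  ... | false = m≤n⇒m≤1+n (count<length xs a∈ pa)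

  count≡0 : ∀ xs → (∀ {a} → a ∈ xs → p a ≡ false) → count p xs ≡ 0
  count≡0 []       _ = refl
  count≡0 (x ∷ xs) h rewrite count-∷ x xs | h (here refl) = count≡0 xs (h ∘ there)

  count≡length : ∀ xs → (∀ {a} → a ∈ xs → p a ≡ true) → count p xs ≡ length xs
  count≡length []       _ = refl
  count≡length (x ∷ xs) h rewrite count-∷ x xs | h (here refl) = cong suc (count≡length xs (h ∘ there))

  count≥1 : ∀ xs {a} → a ∈ xs → p a ≡ true → 1 ≤ count p xs
  count≥1 (x ∷ xs) (here refl) pa rewrite count-∷ x xs | pa = s≤s z≤n
  count≥1 (x ∷ xs) (there a∈) pa rewrite count-∷ x xs = ≤-trans (count≥1 xs a∈ pa) (m≤n+m _ _)

  count>0⇒∃ : ∀ xs → 0 < count p xs → ∃[ a ] (a ∈ xs × p a ≡ true)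
  count>0⇒∃ (x ∷ xs) h rewrite count-∷ x xs with p x in px
  ... | true  = x , here refl , px
  ... | false = let a , a∈ , pa = count>0⇒∃ xs h in a , there a∈ , pa

  count≡0⇒false : ∀ xs → count p xs ≡ 0 → ∀ {a} → a ∈ xs → p a ≡ false
  count≡0⇒false xs c {a} a∈ = ≢true⇒≡false λ pa → contradiction (subst (1 ≤_) c (count≥1 xs a∈ pa)) λ ()

  count≤1 : ∀ xs → Unique xs → (∀ {a b} → a ∈ xs → b ∈ xs → p a ≡ true → p b ≡ true → a ≡ b) → count p xs ≤ 1
  count≤1 []       _          _ = z≤n
  count≤1 (x ∷ xs) (x∉ ∷ xs!) h rewrite count-∷ x xs with p x in px
  ... | false = count≤1 xs xs! λ a∈ b∈ → h (there a∈) (there b∈)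
  ... | true  = s≤s (≤-reflexive (count≡0 xs λ b∈ → ≢true⇒≡false λ pb → All.lookup x∉ b∈ (h (here refl) (there b∈) px pb)))

  count≤1⇒unique : ∀ xs → count p xs ≤ 1 → ∀ {a b} → a ∈ xs → b ∈ xs → p a ≡ true → p b ≡ true → a ≡ b
  count≤1⇒unique (x ∷ xs) c (here refl) (here refl) pa pb = refl
  count≤1⇒unique (x ∷ xs) c (here refl) (there b∈) pa pb rewrite count-∷ x xs | pa =
    contradiction (≤-pred c) (<⇒≱ (count≥1 xs b∈ pb))
  count≤1⇒unique (x ∷ xs) c (there a∈) (here refl) pa pb rewrite count-∷ x xs | pb =
    contradiction (≤-pred c) (<⇒≱ (count≥1 xs a∈ pa))
  count≤1⇒unique (x ∷ xs) c (there a∈) (there b∈) pa pb rewrite count-∷ x xs =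
    count≤1⇒unique xs (≤-trans (m≤n+m _ (indicator (p x))) c) a∈ b∈ pa pb

  count≡1 : ∀ xs → Unique xs → ∀ {a} → a ∈ xs → p a ≡ true → (∀ {b} → b ∈ xs → p b ≡ true → b ≡ a) → count p xs ≡ 1
  count≡1 xs xs! a∈ pa h = ≤-antisym (count≤1 xs xs! λ b∈ c∈ pb pc → trans (h b∈ pb) (sym (h c∈ pc))) (count≥1 xs a∈ pa)

module _ {A : Set} where

  count-cong : ∀ (p q : A → Bool) xs → (∀ {a} → a ∈ xs → p a ≡ q a) → count p xs ≡ count q xs
  count-cong p q []       _ = refl
  count-cong p q (x ∷ xs) h rewrite count-∷ p x xs | count-∷ q x xs | h (here refl) =
    cong (indicator (q x) +_) (count-cong p q xs (h ∘ there))

  count-mono : ∀ (p q : A → Bool) xs → (∀ {a} → a ∈ xs → p a ≡ true → q a ≡ true) → count p xs ≤ count q xs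
  count-mono p q []       _ = z≤n
  count-mono p q (x ∷ xs) h rewrite count-∷ p x xs | count-∷ q x xs =
    +-mono-≤ (indicator-mono (p x) (q x) (h (here refl))) (count-mono p q xs (h ∘ there))

  count-mono-< : ∀ (p q : A → Bool) xs → (∀ {a} → a ∈ xs → p a ≡ true → q a ≡ true) →
                 ∀ {a} → a ∈ xs → p a ≡ false → q a ≡ true → count p xs < count q xs
  count-mono-< p q (x ∷ xs) h (here refl) pa qa rewrite count-∷ p x xs | count-∷ q x xs | pa | qa =
    s≤s (count-mono p q xs (h ∘ there))
  count-mono-< p q (x ∷ xs) h (there a∈) pa qa rewrite count-∷ p x xs | count-∷ q x xs =
    +-mono-≤-< (indicator-mono (p x) (q x) (h (here refl))) (count-mono-< p q xs (h ∘ there) a∈ pa qa)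

  count-+ : ∀ (p q r : A → Bool) xs → (∀ {a} → a ∈ xs → indicator (r a) ≡ indicator (p a) + indicator (q a)) →
            count r xs ≡ count p xs + count q xs
  count-+ p q r []       _ = refl
  count-+ p q r (x ∷ xs) h rewrite count-∷ p x xs | count-∷ q x xs | count-∷ r x xs | h (here refl)
                                 | count-+ p q r xs (h ∘ there) = +-interchange (indicator (p x)) (indicator (q x)) _ _

module _ {A B : Set} where

  count-map : ∀ (p : B → Bool) (f : A → B) xs → count p (map f xs) ≡ count (p ∘ f) xs
  count-map p f []       = refl
  count-map p f (x ∷ xs) rewrite count-∷ p (f x) (map f xs) | count-∷ (p ∘ f) x xs =
    cong (indicator (p (f x)) +_) (count-map p f xs)

  count-concatMap : ∀ (p : B → Bool) (g : A → List B) xs → count p (concatMap g xs) ≡ sum (map (count p ∘ g) xs)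
  count-concatMap p g []       = refl
  count-concatMap p g (x ∷ xs) = trans (count-++ p (g x) (concatMap g xs)) (cong (count p (g x) +_) (count-concatMap p g xs))

multiplicity : ℕ → List ℕ → ℕ
multiplicity k = count (_≡ᵇ k)

Letters : ℕ → List ℕ → Set
Letters n = All (λ v → 1 ≤ v × v ≤ n)

oneTo-suc : ∀ N → oneTo (suc N) ≡ 1 ∷ map suc (oneTo N)
oneTo-suc N = cong (λ xs → 1 ∷ map suc xs) (sym (map-upTo suc N))

∈-oneTo⁻ : ∀ {N k} → k ∈ oneTo N → 1 ≤ k × k ≤ N
∈-oneTo⁻ k∈ with j , j∈ , refl ← ∈-map⁻ suc k∈ = s≤s z≤n , ∈-upTo⁻ j∈

∈-oneTo⁺ : ∀ {N k} → 1 ≤ k → k ≤ N → k ∈ oneTo N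
∈-oneTo⁺ {k = suc k} _ k<N = ∈-map⁺ suc (∈-upTo⁺ k<N)

length-oneTo : ∀ N → length (oneTo N) ≡ N
length-oneTo N = trans (length-map suc (upTo N)) (length-upTo N)

oneTo-unique : ∀ N → Unique (oneTo N)
oneTo-unique N = Unique.map⁺ suc-injective (Unique.upTo⁺ N)

count-oneTo : ∀ N {a} → 1 ≤ a → a ≤ N → multiplicity a (oneTo N) ≡ 1
count-oneTo N {a} 1≤a a≤N =
  count≡1 (_≡ᵇ a) (oneTo N) (oneTo-unique N) (∈-oneTo⁺ 1≤a a≤N) (≡⇒≡ᵇ-true a a refl) (λ {b} _ → ≡ᵇ-true⇒≡ b a)

at-∈ : ∀ xs {k} → 1 ≤ k → k ≤ length xs → at xs k ∈ xs
at-∈ (x ∷ xs) {suc zero}    _ _         = here refl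
at-∈ (x ∷ xs) {suc (suc k)} _ (s≤s k≤) = there (at-∈ xs (s≤s z≤n) k≤)

at-map-oneTo : ∀ (g : ℕ → ℕ) N {k} → 1 ≤ k → k ≤ N → at (map g (oneTo N)) k ≡ g k
at-map-oneTo g (suc N) {suc zero}    _ _         = refl
at-map-oneTo g (suc N) {suc (suc k)} _ (s≤s k≤N) = begin
  at (map g (oneTo (suc N))) (suc (suc k))  ≡⟨ cong (λ xs → at (map g xs) (suc (suc k))) (oneTo-suc N) ⟩
  at (map g (map suc (oneTo N))) (suc k)    ≡⟨ cong (λ xs → at xs (suc k)) (sym (map-∘ (oneTo N))) ⟩
  at (map (g ∘ suc) (oneTo N)) (suc k)      ≡⟨ at-map-oneTo (g ∘ suc) N (s≤s z≤n) k≤N ⟩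
  g (suc (suc k))                           ∎
  where open ≡-Reasoning

map-at-oneTo : ∀ w → map (at w) (oneTo (length w)) ≡ w
map-at-oneTo []      = refl
map-at-oneTo (x ∷ w) = begin
  map (at (x ∷ w)) (oneTo (suc (length w)))         ≡⟨ cong (map (at (x ∷ w))) (oneTo-suc (length w)) ⟩
  x ∷ map (at (x ∷ w)) (map suc (oneTo (length w)))  ≡⟨ cong (x ∷_) (sym (map-∘ (oneTo (length w)))) ⟩
  x ∷ map (at (x ∷ w) ∘ suc) (oneTo (length w))      ≡⟨ cong (x ∷_) (map-cong-local (All.tabulate at-∷-suc)) ⟩
  x ∷ map (at w) (oneTo (length w))                  ≡⟨ cong (x ∷_) (map-at-oneTo w) ⟩
  x ∷ w                                              ∎
  where
  open ≡-Reasoning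
  at-∷-suc : ∀ {k} → k ∈ oneTo (length w) → at (x ∷ w) (suc k) ≡ at w k
  at-∷-suc k∈ with ∈-oneTo⁻ k∈
  ... | s≤s z≤n , _ = refl

IsWord : ℕ → ℕ → List ℕ → Set
IsWord n N w = length w ≡ n × Letters N w

_==_ : List ℕ → List ℕ → Bool
[]       == []       = true
[]       == (_ ∷ _)  = false
(_ ∷ _)  == []       = false
(a ∷ as) == (b ∷ bs) = (a ≡ᵇ b) ∧ (as == bs)

==-true⇒≡ : ∀ u v → (u == v) ≡ true → u ≡ v
==-true⇒≡ []       []       _ = refl
==-true⇒≡ (a ∷ u) (b ∷ v) h = let a≡b , u≡v = ∧-true⁻ h in cong₂ _∷_ (≡ᵇ-true⇒≡ a b a≡b) (==-true⇒≡ u v u≡v)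

==-refl : ∀ u → (u == u) ≡ true
==-refl []      = refl
==-refl (a ∷ u) rewrite ≡⇒≡ᵇ-true a a refl = ==-refl u

≡⇒==-true : ∀ {u v} → u ≡ v → (u == v) ≡ true
≡⇒==-true {u} refl = ==-refl u

∈-words⁻ : ∀ n N {w} → w ∈ words n N → IsWord n N w
∈-words⁻ zero    N (here refl) = refl , []
∈-words⁻ (suc n) N w∈ = go (∈-concatMap⁻ (λ a → map (a ∷_) (words n N)) {xs = oneTo N} w∈) (All.tabulate (λ a∈ → a∈))
  where
  go : ∀ {as w} → Any (λ a → w ∈ map (a ∷_) (words n N)) as → All (_∈ oneTo N) as → IsWord (suc n) N w
  go (here w∈) (a∈ ∷ _) with v , v∈ , refl ← ∈-map⁻ _ w∈ =
    let ∣v∣ , v-letters = ∈-words⁻ n N v∈ in cong suc ∣v∣ , ∈-oneTo⁻ a∈ ∷ v-letters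
  go (there w∈) (_ ∷ as∈) = go w∈ as∈

count-words : ∀ n N {u} → IsWord n N u → count (_== u) (words n N) ≡ 1
count-words zero    N {[]}    _                    = refl
count-words (suc n) N {a ∷ u} (∣u∣ , a∈ ∷ u-letters) = begin
  count (_== (a ∷ u)) (concatMap (λ b → map (b ∷_) (words n N)) (oneTo N))
    ≡⟨ count-concatMap (_== (a ∷ u)) (λ b → map (b ∷_) (words n N)) (oneTo N) ⟩
  sum (map (λ b → count (_== (a ∷ u)) (map (b ∷_) (words n N))) (oneTo N))
    ≡⟨ cong sum (map-cong-local {xs = oneTo N} (All.tabulate (λ {b} _ → block b))) ⟩
  sum (map (λ b → indicator (b ≡ᵇ a)) (oneTo N))
    ≡⟨ sum-indicator (_≡ᵇ a) (oneTo N) ⟩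
  multiplicity a (oneTo N)
    ≡⟨ count-oneTo N (proj₁ a∈) (proj₂ a∈) ⟩
  1 ∎
  where
  open ≡-Reasoning
  block : ∀ b → count (_== (a ∷ u)) (map (b ∷_) (words n N)) ≡ indicator (b ≡ᵇ a)
  block b rewrite count-map (_== (a ∷ u)) (b ∷_) (words n N) with b ≡ᵇ a
  ... | true  = count-words n N (suc-injective ∣u∣ , u-letters)
  ... | false = count≡0 _ (words n N) (λ _ → refl)
  sum-indicator : ∀ (p : ℕ → Bool) xs → sum (map (indicator ∘ p) xs) ≡ count p xs
  sum-indicator p []       = refl
  sum-indicator p (x ∷ xs) = trans (cong (indicator (p x) +_) (sum-indicator p xs)) (sym (count-∷ p x xs))

∈-words⁺ : ∀ n N {w} → IsWord n N w → w ∈ words n N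
∈-words⁺ n N {w} w-word
  with v , v∈ , v==w ← count>0⇒∃ (_== w) (words n N) (subst (0 <_) (sym (count-words n N w-word)) (s≤s z≤n)) =
  subst (_∈ words n N) (==-true⇒≡ v w v==w) v∈

1≤multiplicity-head : ∀ x xs → 1 ≤ multiplicity x (x ∷ xs)
1≤multiplicity-head x xs = count≥1 (_≡ᵇ x) (x ∷ xs) (here refl) (≡⇒≡ᵇ-true x x refl)

1≤multiplicity⇒∈ : ∀ {x} ys → 1 ≤ multiplicity x ys → x ∈ ys
1≤multiplicity⇒∈ {x} ys 1≤m with y , y∈ , y≡ᵇx ← count>0⇒∃ (_≡ᵇ x) ys 1≤m rewrite ≡ᵇ-true⇒≡ y x y≡ᵇx = y∈

↭-fromMultiplicities : ∀ xs ys → (∀ k → multiplicity k xs ≡ multiplicity k ys) → xs ↭ ys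
↭-fromMultiplicities []       []       _ = ↭-refl
↭-fromMultiplicities []       (y ∷ ys) h = contradiction (subst (1 ≤_) (sym (h y)) (1≤multiplicity-head y ys)) λ ()
↭-fromMultiplicities (x ∷ xs) ys       h
  with as , bs , refl ← ∈-∃++ (1≤multiplicity⇒∈ ys (subst (1 ≤_) (h x) (1≤multiplicity-head x xs))) =
  ↭-trans (prep x (↭-fromMultiplicities xs (as ++ bs) multiplicities-rest)) (↭-sym (shift x as bs))
  where
  multiplicities-rest : ∀ k → multiplicity k xs ≡ multiplicity k (as ++ bs)
  multiplicities-rest k = +-cancelˡ-≡ (indicator (x ≡ᵇ k)) _ _ (begin
    indicator (x ≡ᵇ k) + multiplicity k xs                  ≡⟨ sym (count-∷ (_≡ᵇ k) x xs) ⟩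
    multiplicity k (x ∷ xs)                                 ≡⟨ h k ⟩
    multiplicity k (as ++ x ∷ bs)                           ≡⟨ count-++ (_≡ᵇ k) as (x ∷ bs) ⟩
    multiplicity k as + multiplicity k (x ∷ bs)             ≡⟨ cong (multiplicity k as +_) (count-∷ (_≡ᵇ k) x bs) ⟩
    multiplicity k as + (indicator (x ≡ᵇ k) + multiplicity k bs)  ≡⟨ +-comm-middle (multiplicity k as) _ (multiplicity k bs) ⟩
    indicator (x ≡ᵇ k) + (multiplicity k as + multiplicity k bs)  ≡⟨ cong (indicator (x ≡ᵇ k) +_) (sym (count-++ (_≡ᵇ k) as bs)) ⟩
    indicator (x ≡ᵇ k) + multiplicity k (as ++ bs)          ∎)
    where open ≡-Reasoning

OccursOnce : ℕ → List ℕ → Set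
OccursOnce n xs = ∀ {k} → 1 ≤ k → k ≤ n → multiplicity k xs ≡ 1

suc[m∸1]≡m : ∀ {m} → 1 ≤ m → suc (m ∸ 1) ≡ m
suc[m∸1]≡m {suc m} _ = refl

indicator-<ᵇ-suc : ∀ v m → indicator (v <ᵇ suc m) ≡ indicator (v <ᵇ m) + indicator (v ≡ᵇ m)
indicator-<ᵇ-suc zero    zero    = refl
indicator-<ᵇ-suc zero    (suc m) = refl
indicator-<ᵇ-suc (suc v) zero    = refl
indicator-<ᵇ-suc (suc v) (suc m) = indicator-<ᵇ-suc v m

count-<ᵇ-suc : ∀ xs m → count (_<ᵇ suc m) xs ≡ count (_<ᵇ m) xs + multiplicity m xs
count-<ᵇ-suc xs m = count-+ (_<ᵇ m) (_≡ᵇ m) (_<ᵇ suc m) xs λ {v} _ → indicator-<ᵇ-suc v m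

count-<ᵇ-1 : ∀ {n} xs → Letters n xs → count (_<ᵇ 1) xs ≡ 0
count-<ᵇ-1 xs letters = count≡0 (_<ᵇ 1) xs λ v∈ → ≥⇒<ᵇ-false (proj₁ (All.lookup letters v∈))

count-<ᵇ-occursOnce : ∀ {n} xs → Letters n xs → OccursOnce n xs → ∀ {m} → 1 ≤ m → m ≤ suc n → count (_<ᵇ m) xs ≡ m ∸ 1
count-<ᵇ-occursOnce xs letters once {suc zero}    _ _         = count-<ᵇ-1 xs letters
count-<ᵇ-occursOnce xs letters once {suc (suc m)} _ (s≤s m<n) = begin
  count (_<ᵇ suc (suc m)) xs                           ≡⟨ count-<ᵇ-suc xs (suc m) ⟩
  count (_<ᵇ suc m) xs + multiplicity (suc m) xs      ≡⟨ cong₂ _+_ (count-<ᵇ-occursOnce xs letters once (s≤s z≤n) (m≤n⇒m≤1+n m<n))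
                                                                    (once (s≤s z≤n) m<n) ⟩
  m + 1                                                ≡⟨ +-comm m 1 ⟩
  suc m                                                ∎
  where open ≡-Reasoning

AtMostOnce : List ℕ → Set
AtMostOnce xs = ∀ k → multiplicity k xs ≤ 1

count-<ᵇ-bound : ∀ {n} xs → Letters n xs → AtMostOnce xs → ∀ {m} → 1 ≤ m → count (_<ᵇ m) xs ≤ m ∸ 1
count-<ᵇ-bound xs letters once {suc zero}    _ = ≤-reflexive (count-<ᵇ-1 xs letters)
count-<ᵇ-bound xs letters once {suc (suc m)} _ = begin
  count (_<ᵇ suc (suc m)) xs                      ≡⟨ count-<ᵇ-suc xs (suc m) ⟩
  count (_<ᵇ suc m) xs + multiplicity (suc m) xs ≤⟨ +-mono-≤ (count-<ᵇ-bound xs letters once (s≤s z≤n)) (once (suc m)) ⟩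
  m + 1                                           ≡⟨ +-comm m 1 ⟩
  suc m                                           ∎
  where open ≤-Reasoning

count-<ᵇ-+ : ∀ xs → AtMostOnce xs → ∀ m j → count (_<ᵇ (m + j)) xs ≤ count (_<ᵇ m) xs + j
count-<ᵇ-+ xs once m zero    = ≤-reflexive (trans (cong (λ k → count (_<ᵇ k) xs) (+-identityʳ m)) (sym (+-identityʳ _)))
count-<ᵇ-+ xs once m (suc j) = begin
  count (_<ᵇ (m + suc j)) xs                          ≡⟨ cong (λ k → count (_<ᵇ k) xs) (+-suc m j) ⟩
  count (_<ᵇ suc (m + j)) xs                          ≡⟨ count-<ᵇ-suc xs (m + j) ⟩
  count (_<ᵇ (m + j)) xs + multiplicity (m + j) xs    ≤⟨ +-mono-≤ (count-<ᵇ-+ xs once m j) (once (m + j)) ⟩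
  count (_<ᵇ m) xs + j + 1                            ≡⟨ +-assoc (count (_<ᵇ m) xs) j 1 ⟩
  count (_<ᵇ m) xs + (j + 1)                          ≡⟨ cong (count (_<ᵇ m) xs +_) (+-comm j 1) ⟩
  count (_<ᵇ m) xs + suc j                            ∎
  where open ≤-Reasoning

-- The number of letters below m grows by at most one per step, from 0 at m = 1 to n at m = n + 1,
-- so it grows at every step; a missing letter k would make it stall at m = k.
pigeonhole : ∀ {n} xs → length xs ≡ n → Letters n xs → AtMostOnce xs → OccursOnce n xs
pigeonhole {n} xs ∣xs∣ letters once {k} 1≤k k≤n with multiplicity k xs in mult-k
... | suc zero    = refl
... | suc (suc _) = contradiction (subst (_≤ 1) mult-k (once k)) λ { (s≤s ()) }
... | zero        = contradiction counted (<⇒≱ (≤-reflexive short))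
  where
  below : ℕ → ℕ
  below m = count (_<ᵇ m) xs
  all-below : below (suc n) ≡ n
  all-below = trans (count≡length (_<ᵇ suc n) xs λ v∈ → <⇒<ᵇ-true (s≤s (proj₂ (All.lookup letters v∈)))) ∣xs∣
  counted : n ≤ (k ∸ 1) + (n ∸ k)
  counted = begin
    n                        ≡⟨ sym all-below ⟩
    below (suc n)            ≡⟨ cong below (sym (cong suc (m+[n∸m]≡n k≤n))) ⟩
    below (suc k + (n ∸ k))  ≤⟨ count-<ᵇ-+ xs once (suc k) (n ∸ k) ⟩
    below (suc k) + (n ∸ k)  ≡⟨ cong (_+ (n ∸ k)) (trans (count-<ᵇ-suc xs k) (trans (cong (below k +_) mult-k) (+-identityʳ _))) ⟩
    below k + (n ∸ k)        ≤⟨ +-monoˡ-≤ (n ∸ k) (count-<ᵇ-bound xs letters once 1≤k) ⟩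
    (k ∸ 1) + (n ∸ k)        ∎
    where open ≤-Reasoning
  short : suc ((k ∸ 1) + (n ∸ k)) ≡ n
  short = trans (cong (_+ (n ∸ k)) (suc[m∸1]≡m 1≤k)) (m+[n∸m]≡n k≤n)

multiplicity-outside : ∀ {n} xs → Letters n xs → ∀ {k} → ¬ (1 ≤ k × k ≤ n) → multiplicity k xs ≡ 0
multiplicity-outside xs letters {k} k∉ =
  count≡0 (_≡ᵇ k) xs λ {v} v∈ → ≢⇒≡ᵇ-false v k λ { refl → k∉ (All.lookup letters v∈) }

occursOnce⇒↭-oneTo : ∀ {n} xs → Letters n xs → OccursOnce n xs → xs ↭ oneTo n
occursOnce⇒↭-oneTo {n} xs letters once = ↭-fromMultiplicities xs (oneTo n) same
  where
  same : ∀ k → multiplicity k xs ≡ multiplicity k (oneTo n)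
  same k with 1 ≤? k | k ≤? n
  ... | yes 1≤k | yes k≤n = trans (once 1≤k k≤n) (sym (count-oneTo n 1≤k k≤n))
  ... | no 1≰k  | _       = trans (multiplicity-outside xs letters (1≰k ∘ proj₁))
                                  (sym (multiplicity-outside (oneTo n) (All.tabulate ∈-oneTo⁻) (1≰k ∘ proj₁)))
  ... | _       | no k≰n  = trans (multiplicity-outside xs letters (k≰n ∘ proj₂))
                                  (sym (multiplicity-outside (oneTo n) (All.tabulate ∈-oneTo⁻) (k≰n ∘ proj₂)))

findOr : {A : Set} → (A → Bool) → A → List A → A
findOr p d []       = d
findOr p d (x ∷ xs) = if p x then x else findOr p d xs

findOr-spec : ∀ {A : Set} (p : A → Bool) d xs {a} → a ∈ xs → p a ≡ true → findOr p d xs ∈ xs × p (findOr p d xs) ≡ true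
findOr-spec p d (x ∷ xs) a∈ pa with p x in px | a∈
... | true  | _          = here refl , px
... | false | here refl  = contradiction (trans (sym px) pa) λ ()
... | false | there a∈′ = let found∈ , found = findOr-spec p d xs a∈′ pa in there found∈ , found

StrictChain : ℕ → List ℕ → ℕ → Set
StrictChain a []       n = a ≤ n
StrictChain a (t ∷ ts) n = a < t × StrictChain t ts n

-- `comp n ts` is `compFrom 0 ts n`; the starting point is generalised for the induction.
compFrom : ℕ → List ℕ → ℕ → List ℕ
compFrom a ts n = zipWith _∸_ (ts ++ [ n ]) (a ∷ ts)

chain-weaken : ∀ {a b} ts {n} → a ≤ b → StrictChain b ts n → StrictChain a ts n
chain-weaken []       a≤b b≤n        = ≤-trans a≤b b≤n
chain-weaken (t ∷ ts) a≤b (b<t , ch) = ≤-<-trans a≤b b<t , ch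

chain-filter : ∀ (p : ℕ → Bool) {a} ts {n} → StrictChain a ts n → StrictChain a (filterᵇ p ts) n
chain-filter p []       ch         = ch
chain-filter p (t ∷ ts) (a<t , ch) with p t
... | true  = a<t , chain-filter p ts ch
... | false = chain-filter p ts (chain-weaken ts (<⇒≤ a<t) ch)

chain-lower : ∀ {a} ts {n} → StrictChain a ts n → All (a <_) ts
chain-lower []       _          = []
chain-lower (t ∷ ts) (a<t , ch) = a<t ∷ All.map (<-trans a<t) (chain-lower ts ch)

chain-suc : ∀ {a} ts {n} → StrictChain a ts n → StrictChain (suc a) (map suc ts) (suc n)
chain-suc []       a≤n        = s≤s a≤n
chain-suc (t ∷ ts) (a<t , ch) = s≤s a<t , chain-suc ts ch

chain-oneTo : ∀ m → StrictChain 0 (oneTo m) (suc m)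
chain-oneTo zero    = z≤n
chain-oneTo (suc m) =
  subst (λ ts → StrictChain 0 ts (suc (suc m))) (sym (oneTo-suc m)) (s≤s z≤n , chain-suc (oneTo m) (chain-oneTo m))

chain-oneTo-pred : ∀ n → StrictChain 0 (oneTo (n ∸ 1)) n
chain-oneTo-pred zero    = z≤n
chain-oneTo-pred (suc m) = chain-oneTo m

sum-compFrom : ∀ {a} ts {n} → StrictChain a ts n → sum (compFrom a ts n) + a ≡ n
sum-compFrom {a} []       {n} a≤n        = trans (cong (_+ a) (+-identityʳ (n ∸ a))) (m∸n+n≡m a≤n)
sum-compFrom {a} (t ∷ ts) {n} (a<t , ch) = begin
  (t ∸ a) + sum (compFrom t ts n) + a  ≡⟨ +-assoc (t ∸ a) _ a ⟩
  (t ∸ a) + (sum (compFrom t ts n) + a) ≡⟨ cong ((t ∸ a) +_) (+-comm _ a) ⟩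
  (t ∸ a) + (a + sum (compFrom t ts n)) ≡⟨ sym (+-assoc (t ∸ a) a _) ⟩
  (t ∸ a) + a + sum (compFrom t ts n)   ≡⟨ cong (_+ sum (compFrom t ts n)) (m∸n+n≡m (<⇒≤ a<t)) ⟩
  t + sum (compFrom t ts n)             ≡⟨ +-comm t _ ⟩
  sum (compFrom t ts n) + t             ≡⟨ sum-compFrom ts ch ⟩
  n                                     ∎
  where open ≡-Reasoning

sub-compFrom : ∀ {a} ts {n} → StrictChain a ts n → sub (compFrom a ts n) ≡ map (_∸ a) ts
sub-compFrom []           _ = refl
sub-compFrom (t ∷ [])     _ = refl
sub-compFrom {a} (t ∷ u ∷ ts) {n} (a<t , ch) = cong ((t ∸ a) ∷_) (begin
  map ((t ∸ a) +_) (sub (compFrom t (u ∷ ts) n)) ≡⟨ cong (map ((t ∸ a) +_)) (sub-compFrom (u ∷ ts) ch) ⟩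
  map ((t ∸ a) +_) (map (_∸ t) (u ∷ ts))        ≡⟨ sym (map-∘ (u ∷ ts)) ⟩
  map (λ v → (t ∸ a) + (v ∸ t)) (u ∷ ts)        ≡⟨ map-cong-local (All.map telescope (chain-lower (u ∷ ts) ch)) ⟩
  map (_∸ a) (u ∷ ts)                           ∎)
  where
  open ≡-Reasoning
  telescope : ∀ {v} → t < v → (t ∸ a) + (v ∸ t) ≡ v ∸ a
  telescope {v} t<v = +-cancelʳ-≡ a _ _ (begin
    (t ∸ a) + (v ∸ t) + a  ≡⟨ +-assoc (t ∸ a) (v ∸ t) a ⟩
    (t ∸ a) + ((v ∸ t) + a) ≡⟨ cong ((t ∸ a) +_) (+-comm (v ∸ t) a) ⟩
    (t ∸ a) + (a + (v ∸ t)) ≡⟨ sym (+-assoc (t ∸ a) a (v ∸ t)) ⟩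
    (t ∸ a) + a + (v ∸ t)   ≡⟨ cong (_+ (v ∸ t)) (m∸n+n≡m (<⇒≤ a<t)) ⟩
    t + (v ∸ t)             ≡⟨ m+[n∸m]≡n (<⇒≤ t<v) ⟩
    v                       ≡⟨ sym (m∸n+n≡m (<⇒≤ (<-trans a<t t<v))) ⟩
    (v ∸ a) + a             ∎)

sum-comp : ∀ n ts → StrictChain 0 ts n → sum (comp n ts) ≡ n
sum-comp n ts ch = trans (sym (+-identityʳ _)) (sum-compFrom ts ch)

sub-comp : ∀ n ts → StrictChain 0 ts n → sub (comp n ts) ≡ ts
sub-comp n ts ch = trans (sub-compFrom ts ch) (map-id ts)

∈-subsets⁻ : ∀ {A : Set} (M : List A) {E} → E ∈ subsets M → All (_∈ M) E
∈-subsets⁻ []      (here refl) = []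
∈-subsets⁻ (y ∷ M) E∈ with ∈-++⁻ (subsets M) E∈
... | inj₁ E∈M = All.map there (∈-subsets⁻ M E∈M)
... | inj₂ E∈yM with E′ , E′∈ , refl ← ∈-map⁻ (y ∷_) E∈yM = here refl ∷ All.map there (∈-subsets⁻ M E′∈)

filterᵇ-map : ∀ {A B : Set} (P : B → Bool) (Q : A → Bool) (f : A → B) xs → (∀ a → P (f a) ≡ Q a) →
              filterᵇ P (map f xs) ≡ map f (filterᵇ Q xs)
filterᵇ-map P Q f []       _ = refl
filterᵇ-map P Q f (x ∷ xs) h rewrite h x with Q x
... | true  = cong (f x ∷_) (filterᵇ-map P Q f xs h)
... | false = filterᵇ-map P Q f xs h

subsets-filterᵇ : ∀ {A : Set} (p q : A → Bool) xs → (∀ {a} → a ∈ xs → p a ≡ true → q a ≡ true) →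
                  subsets (filterᵇ p xs) ≡ filterᵇ (all p) (subsets (filterᵇ q xs))
subsets-filterᵇ p q []       _ = refl
subsets-filterᵇ p q (y ∷ xs) h with p y in py | q y in qy
... | true  | false = contradiction (trans (sym (h (here refl) py)) qy) λ ()
... | false | false = subsets-filterᵇ p q xs (h ∘ there)
... | true  | true  = begin
  S ++ map (y ∷_) S
    ≡⟨ cong₂ (λ A B → A ++ map (y ∷_) B) ih ih ⟩
  filterᵇ (all p) Sq ++ map (y ∷_) (filterᵇ (all p) Sq)
    ≡⟨ cong (filterᵇ (all p) Sq ++_) (sym (filterᵇ-map (all p) (all p) (y ∷_) Sq (λ E → cong (_∧ all p E) py))) ⟩
  filterᵇ (all p) Sq ++ filterᵇ (all p) (map (y ∷_) Sq)
    ≡⟨ sym (filter-++ (T? ∘ all p) Sq _) ⟩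
  filterᵇ (all p) (Sq ++ map (y ∷_) Sq) ∎
  where
  open ≡-Reasoning
  S Sq : List (List _)
  S  = subsets (filterᵇ p xs)
  Sq = subsets (filterᵇ q xs)
  ih : S ≡ filterᵇ (all p) Sq
  ih = subsets-filterᵇ p q xs (h ∘ there)
... | false | true  = begin
  subsets (filterᵇ p xs)
    ≡⟨ subsets-filterᵇ p q xs (h ∘ there) ⟩
  filterᵇ (all p) Sq
    ≡⟨ sym (++-identityʳ _) ⟩
  filterᵇ (all p) Sq ++ []
    ≡⟨ cong (filterᵇ (all p) Sq ++_) (sym (trans (filterᵇ-map (all p) (λ _ → false) (y ∷_) Sq (λ E → cong (_∧ all p E) py))
                                                 (cong (map (y ∷_)) (filter-none (T? ∘ λ _ → false) {xs = Sq} (All.tabulate λ _ ()))))) ⟩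
  filterᵇ (all p) Sq ++ filterᵇ (all p) (map (y ∷_) Sq)
    ≡⟨ sym (filter-++ (T? ∘ all p) Sq _) ⟩
  filterᵇ (all p) (Sq ++ map (y ∷_) Sq) ∎
  where
  open ≡-Reasoning
  Sq : List (List _)
  Sq = subsets (filterᵇ q xs)

module Sums (R : CommutativeRing 0ℓ 0ℓ) where

  open CommutativeRing R
    renaming ( _+_ to _+R_; _*_ to _*R_; refl to ≈-refl; sym to ≈-sym; trans to ≈-trans; reflexive to ≈-reflexive
             ; +-assoc to +R-assoc; +-comm to +R-comm; +-identityʳ to +R-identityʳ
             ; +-commutativeSemigroup to +R-commutativeSemigroup )
  open Eval R using (pow; Σ'; Π')
  open CommutativeSemigroupProperties +R-commutativeSemigroup using () renaming (interchange to +R-interchange)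
  open CommutativeSemigroupProperties *-commutativeSemigroup using () renaming (interchange to *R-interchange)
  open RingProperties ring using (-1*x≈-x)
  open PermutationProperties setoid using (foldr-commMonoid)
  open import Relation.Binary.Reasoning.Setoid setoid

  ∑ : {A : Set} → (A → Carrier) → List A → Carrier
  ∑ f xs = Σ' (map f xs)

  when : Bool → Carrier → Carrier
  when true  v = v
  when false _ = 0#

  module _ {A : Set} where

    ∑-++ : ∀ (f : A → Carrier) xs ys → ∑ f (xs ++ ys) ≈ ∑ f xs +R ∑ f ys
    ∑-++ f []       ys = ≈-sym (+-identityˡ _)
    ∑-++ f (x ∷ xs) ys = ≈-trans (+-congˡ (∑-++ f xs ys)) (≈-sym (+R-assoc _ _ _))

    ∑-cong : ∀ {f g : A → Carrier} xs → (∀ {a} → a ∈ xs → f a ≈ g a) → ∑ f xs ≈ ∑ g xs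
    ∑-cong []       _ = ≈-refl
    ∑-cong (x ∷ xs) h = +-cong (h (here refl)) (∑-cong xs (h ∘ there))

    ∑-zero : ∀ {f : A → Carrier} xs → (∀ {a} → a ∈ xs → f a ≈ 0#) → ∑ f xs ≈ 0#
    ∑-zero []       _ = ≈-refl
    ∑-zero (x ∷ xs) h = ≈-trans (+-cong (h (here refl)) (∑-zero xs (h ∘ there))) (+-identityˡ 0#)

    ∑-+ : ∀ (f g : A → Carrier) xs → ∑ f xs +R ∑ g xs ≈ ∑ (λ a → f a +R g a) xs
    ∑-+ f g []       = +-identityˡ 0#
    ∑-+ f g (x ∷ xs) = ≈-trans (+R-interchange _ _ _ _) (+-congˡ (∑-+ f g xs))

    *-∑ : ∀ c (f : A → Carrier) xs → c *R ∑ f xs ≈ ∑ (λ a → c *R f a) xs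
    *-∑ c f []       = zeroʳ c
    *-∑ c f (x ∷ xs) = ≈-trans (distribˡ c _ _) (+-congˡ (*-∑ c f xs))

    ∑-* : ∀ (f : A → Carrier) xs c → ∑ f xs *R c ≈ ∑ (λ a → f a *R c) xs
    ∑-* f xs c = ≈-trans (*-comm _ c) (≈-trans (*-∑ c f xs) (∑-cong xs λ _ → *-comm c _))

    ∑-filterᵇ : ∀ (p : A → Bool) (f : A → Carrier) xs → ∑ f (filterᵇ p xs) ≈ ∑ (λ a → when (p a) (f a)) xs
    ∑-filterᵇ p f []       = ≈-refl
    ∑-filterᵇ p f (x ∷ xs) with p x
    ... | true  = +-congˡ (∑-filterᵇ p f xs)
    ... | false = ≈-trans (∑-filterᵇ p f xs) (≈-sym (+-identityˡ _))

    when-∑ : ∀ b (f : A → Carrier) xs → when b (∑ f xs) ≈ ∑ (λ a → when b (f a)) xs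
    when-∑ true  f xs = ≈-refl
    when-∑ false f xs = ≈-sym (∑-zero xs λ _ → ≈-refl)

    ∑-single : ∀ (p : A → Bool) (f : A → Carrier) xs {v} → count p xs ≡ 1 →
               (∀ {a} → a ∈ xs → p a ≡ true → f a ≈ v) → (∀ {a} → a ∈ xs → p a ≡ false → f a ≈ 0#) → ∑ f xs ≈ v
    ∑-single p f (x ∷ xs) {v} c on off with p x in px
    ... | true  = ≈-trans (+-cong (on (here refl) px) (∑-zero xs λ a∈ → off (there a∈) (count≡0⇒false p xs (suc-injective c) a∈)))
                          (+R-identityʳ v)
    ... | false = ≈-trans (+-cong (off (here refl) px) (∑-single p f xs c (on ∘ there) (off ∘ there))) (+-identityˡ v)

  ∑-swap : ∀ {A B : Set} (f : A → B → Carrier) xs ys → ∑ (λ a → ∑ (f a) ys) xs ≈ ∑ (λ b → ∑ (λ a → f a b) xs) ys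
  ∑-swap f []       ys = ≈-sym (∑-zero ys λ _ → ≈-refl)
  ∑-swap f (x ∷ xs) ys = ≈-trans (+-congˡ (∑-swap f xs ys)) (∑-+ (f x) _ ys)

  ∑-map : ∀ {A B : Set} (f : B → Carrier) (g : A → B) xs → ∑ f (map g xs) ≈ ∑ (f ∘ g) xs
  ∑-map f g xs = ≈-reflexive (cong Σ' (sym (map-∘ xs)))

  when-cong³ : ∀ {a a′ b b′ c c′} v → a ≡ a′ → b ≡ b′ → c ≡ c′ → when a (when b (when c v)) ≡ when a′ (when b′ (when c′ v))
  when-cong³ v refl refl refl = refl

  *-when : ∀ b c v → c *R when b v ≈ when b (c *R v)
  *-when true  c v = ≈-refl
  *-when false c v = zeroʳ c

  when-cong : ∀ b {u v} → (b ≡ true → u ≈ v) → when b u ≈ when b v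
  when-cong true  h = h refl
  when-cong false _ = ≈-refl

  pow-+ : ∀ a m n → pow a (m + n) ≈ pow a m *R pow a n
  pow-+ a zero    n = ≈-sym (*-identityˡ _)
  pow-+ a (suc m) n = ≈-trans (*-congˡ (pow-+ a m n)) (≈-sym (*-assoc _ _ _))

  Π'-↭ : ∀ {xs ys} → xs ↭ ys → Π' xs ≈ Π' ys
  Π'-↭ p = foldr-commMonoid *-isCommutativeMonoid (↭⇒↭ₛ′ isEquivalence p)

  signedPower : {A : Set} → Carrier → (A → ℕ) → List A → Carrier
  signedPower t h E = pow (- 1#) (length E) *R pow t (sum (map h E))

  signedPower-cong : ∀ {A : Set} t {h h′ : A → ℕ} E → (∀ {e} → e ∈ E → h e ≡ h′ e) → signedPower t h E ≡ signedPower t h′ E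
  signedPower-cong t E h≡h′ = cong (λ ws → pow (- 1#) (length E) *R pow t (sum ws)) (map-cong-local (All.tabulate h≡h′))

  ∏-1-pow≈∑-subsets : ∀ {A : Set} t (h : A → ℕ) xs →
                      Π' (map (λ c → 1# +R - pow t (h c)) xs) ≈ ∑ (signedPower t h) (subsets xs)
  ∏-1-pow≈∑-subsets t h []       = ≈-sym (≈-trans (+R-identityʳ _) (*-identityˡ _))
  ∏-1-pow≈∑-subsets t h (x ∷ xs) = begin
      (1# +R - P) *R Π' (map (λ c → 1# +R - pow t (h c)) xs)
    ≈⟨ *-congˡ (∏-1-pow≈∑-subsets t h xs) ⟩
      (1# +R - P) *R S
    ≈⟨ distribʳ S 1# (- P) ⟩
      1# *R S +R - P *R S
    ≈⟨ +-cong (*-identityˡ S) (*-∑ (- P) (signedPower t h) (subsets xs)) ⟩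
      S +R ∑ (λ E → - P *R signedPower t h E) (subsets xs)
    ≈⟨ +-congˡ (≈-sym (≈-trans (∑-map (signedPower t h) (x ∷_) (subsets xs)) (∑-cong (subsets xs) λ {E} _ → cons E))) ⟩
      S +R ∑ (signedPower t h) (map (x ∷_) (subsets xs))
    ≈⟨ ≈-sym (∑-++ (signedPower t h) (subsets xs) (map (x ∷_) (subsets xs))) ⟩
      ∑ (signedPower t h) (subsets xs ++ map (x ∷_) (subsets xs))
    ∎
    where
    P S : Carrier
    P = pow t (h x)
    S = ∑ (signedPower t h) (subsets xs)
    cons : ∀ E → signedPower t h (x ∷ E) ≈ - P *R signedPower t h E
    cons E = begin
        (- 1# *R pow (- 1#) (length E)) *R pow t (h x + sum (map h E))
      ≈⟨ *-congˡ (pow-+ t (h x) (sum (map h E))) ⟩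
        (- 1# *R pow (- 1#) (length E)) *R (P *R pow t (sum (map h E)))
      ≈⟨ *R-interchange _ _ _ _ ⟩
        (- 1# *R P) *R signedPower t h E
      ≈⟨ *-congʳ (-1*x≈-x P) ⟩
        - P *R signedPower t h E
      ∎

∈-between⁻ : ∀ a b {j} → j ∈ between a b → a < j × j ≤ b
∈-between⁻ a b j∈ with k , k∈ , refl ← ∈-map⁻ (λ k → a + suc k) j∈ =
  m<m+n a (s≤s z≤n) , ≤-trans (+-monoʳ-≤ a k<b∸a) (≤-reflexive (m+[n∸m]≡n (<⇒≤ a<b)))
  where
  k<b∸a : k < b ∸ a
  k<b∸a = ∈-upTo⁻ k∈
  a<b : a < b
  a<b = m∸n≢0⇒n<m λ b∸a≡0 → n≮0 (subst (k <_) b∸a≡0 k<b∸a)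

∈-between⁺ : ∀ a b {j} → a < j → j ≤ b → j ∈ between a b
∈-between⁺ a b {suc j} (s≤s a≤j) j<b = subst (_∈ between a b) (trans (+-suc a (j ∸ a)) (cong suc (m+[n∸m]≡n a≤j)))
                                              (∈-map⁺ (λ k → a + suc k) (∈-upTo⁺ (∸-monoˡ-< j<b a≤j)))

-- The only geometric property of skew shapes that standardisation needs.
RectangleClosed : List Cell → Set
RectangleClosed cs = ∀ {c d} → c ∈ cs → d ∈ cs → row c < row d → col c ≤ col d → (row c , col d) ∈ cs

at-suc-≤ : ∀ {xs} → Linked (λ a b → b ≤ a) xs → ∀ i → at xs (suc (suc i)) ≤ at xs (suc i)
at-suc-≤ {[]}         _          _       = z≤n
at-suc-≤ {x ∷ []}     _          zero    = z≤n
at-suc-≤ {x ∷ []}     _          (suc i) = z≤n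
at-suc-≤ {x ∷ y ∷ xs} (y≤x ∷ _)  zero    = y≤x
at-suc-≤ {x ∷ y ∷ xs} (_ ∷ y∷xs) (suc i) = at-suc-≤ y∷xs i

module SkewDiagram (lam mu : List ℕ) where

  InDiagram : Cell → Set
  InDiagram (i , j) = (1 ≤ i × i ≤ length lam) × (at mu i < j × j ≤ at lam i)

  rowCells : ℕ → List Cell
  rowCells i = map (i ,_) (between (at mu i) (at lam i))

  ∈-cells⁻ : ∀ {c} → c ∈ cells lam mu → InDiagram c
  ∈-cells⁻ c∈ = go (∈-concatMap⁻ rowCells {xs = oneTo (length lam)} c∈) (All.tabulate ∈-oneTo⁻)
    where
    go : ∀ {is c} → Any (λ i → c ∈ rowCells i) is → All (λ i → 1 ≤ i × i ≤ length lam) is → InDiagram c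
    go (here c∈) (i-bounds ∷ _) with j , j∈ , refl ← ∈-map⁻ _ c∈ = i-bounds , ∈-between⁻ _ _ j∈
    go (there c∈) (_ ∷ is)      = go c∈ is

  ∈-cells⁺ : ∀ {i j} → 1 ≤ i → i ≤ length lam → at mu i < j → j ≤ at lam i → (i , j) ∈ cells lam mu
  ∈-cells⁺ {i} 1≤i i≤ℓ μ<j j≤λ =
    ∈-concatMap⁺ rowCells (Any.map (λ { refl → ∈-map⁺ (i ,_) (∈-between⁺ _ _ μ<j j≤λ) }) (∈-oneTo⁺ 1≤i i≤ℓ))

  cells-unique : Unique (cells lam mu)
  cells-unique = concat-unique (oneTo (length lam)) (oneTo-unique (length lam))
    where
    rowCells-row : ∀ {i c} → c ∈ rowCells i → row c ≡ i
    rowCells-row c∈ with _ , _ , refl ← ∈-map⁻ _ c∈ = refl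
    rowCells-unique : ∀ i → Unique (rowCells i)
    rowCells-unique i = Unique.map⁺ (cong col) (Unique.map⁺ (suc-injective ∘ +-cancelˡ-≡ (at mu i) _ _) (Unique.upTo⁺ _))
    concat-unique : ∀ is → Unique is → Unique (concatMap rowCells is)
    concat-unique []       _          = []
    concat-unique (i ∷ is) (i∉ ∷ is!) = Unique.++⁺ (rowCells-unique i) (concat-unique is is!) disjoint
      where
      disjoint : ∀ {c} → ¬ (c ∈ rowCells i × c ∈ concatMap rowCells is)
      disjoint (c∈i , c∈is) = elsewhere (∈-concatMap⁻ rowCells {xs = is} c∈is) i∉
        where
        elsewhere : ∀ {js} → Any (λ k → _ ∈ rowCells k) js → ¬ All (i ≢_) js
        elsewhere (here c∈k) (i≢k ∷ _) = i≢k (trans (sym (rowCells-row c∈i)) (rowCells-row c∈k))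
        elsewhere (there c∈) (_ ∷ js)  = elsewhere c∈ js

  module _ (lam-partition : IsPartition lam) where

    at-antitone : ∀ {i k} → 1 ≤ i → i ≤ k → at lam k ≤ at lam i
    at-antitone {suc i} _ i≤k with m , refl ← m≤n⇒∃[o]m+o≡n i≤k = go m
      where
      go : ∀ m → at lam (suc i + m) ≤ at lam (suc i)
      go zero    = ≤-reflexive (cong (at lam) (+-identityʳ (suc i)))
      go (suc m) = ≤-trans
        (subst (λ k → at lam k ≤ at lam (suc i + m)) (sym (+-suc (suc i) m)) (at-suc-≤ (proj₁ lam-partition) (i + m)))
        (go m)

    cells-rectangleClosed : RectangleClosed (cells lam mu)
    cells-rectangleClosed {c} {d} c∈ d∈ rc<rd cc≤cd =
      ∈-cells⁺ (proj₁ (proj₁ c-in)) (proj₂ (proj₁ c-in)) (<-≤-trans (proj₁ (proj₂ c-in)) cc≤cd)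
               (≤-trans (proj₂ (proj₂ d-in)) (at-antitone (proj₁ (proj₁ c-in)) (<⇒≤ rc<rd)))
      where
      c-in : InDiagram c
      c-in = ∈-cells⁻ c∈
      d-in : InDiagram d
      d-in = ∈-cells⁻ d∈

sameCell : Cell → Cell → Bool
sameCell d c = (row d ≡ᵇ row c) ∧ (col d ≡ᵇ col c)

sameCell-true⇒≡ : ∀ {d c} → sameCell d c ≡ true → d ≡ c
sameCell-true⇒≡ {a , b} {a′ , b′} h = let a≡ , b≡ = ∧-true⁻ h in cong₂ _,_ (≡ᵇ-true⇒≡ a a′ a≡) (≡ᵇ-true⇒≡ b b′ b≡)

sameCell-refl : ∀ c → sameCell c c ≡ true
sameCell-refl (a , b) = ∧-true⁺ (≡⇒≡ᵇ-true a a refl) (≡⇒≡ᵇ-true b b refl)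

≢⇒sameCell-false : ∀ {d c} → d ≢ c → sameCell d c ≡ false
≢⇒sameCell-false d≢c = ≢true⇒≡false (d≢c ∘ sameCell-true⇒≡)

fill-∷ : ∀ d cs v vs c → fill (d ∷ cs) (v ∷ vs) c ≡ (if sameCell d c then v else fill cs vs c)
fill-∷ (i , j) cs v vs c with (i ≡ᵇ row c) ∧ (j ≡ᵇ col c)
... | true  = refl
... | false = refl

fill-map : ∀ (f : Cell → ℕ) cs {c} → c ∈ cs → fill cs (map f cs) c ≡ f c
fill-map f (d ∷ cs) {c} c∈ rewrite fill-∷ d cs (f d) (map f cs) c with sameCell d c in same | c∈
... | true  | _          = cong f (sameCell-true⇒≡ same)
... | false | here refl  = contradiction (trans (sym same) (sameCell-refl c)) λ ()
... | false | there c∈′ = fill-map f cs c∈′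

values≡map-fill : ∀ cs vs → Unique cs → length vs ≡ length cs → vs ≡ map (fill cs vs) cs
values≡map-fill []       []       _          _ = refl
values≡map-fill (d ∷ cs) (v ∷ vs) (d∉ ∷ cs!) ∣vs∣ =
  cong₂ _∷_ (sym head-value) (trans (values≡map-fill cs vs cs! (suc-injective ∣vs∣)) (map-cong-local (All.tabulate tail-value)))
  where
  head-value : fill (d ∷ cs) (v ∷ vs) d ≡ v
  head-value rewrite fill-∷ d cs v vs d | sameCell-refl d = refl
  tail-value : ∀ {c} → c ∈ cs → fill cs vs c ≡ fill (d ∷ cs) (v ∷ vs) c
  tail-value {c} c∈ rewrite fill-∷ d cs v vs c | ≢⇒sameCell-false (All.lookup d∉ c∈) = refl

fill-map-values : ∀ (g : ℕ → ℕ) cs vs → Unique cs → length vs ≡ length cs →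
                  ∀ {c} → c ∈ cs → fill cs (map g vs) c ≡ g (fill cs vs c)
fill-map-values g cs vs cs! ∣vs∣ {c} c∈ = begin
  fill cs (map g vs) c                     ≡⟨ cong (λ ws → fill cs (map g ws) c) (values≡map-fill cs vs cs! ∣vs∣) ⟩
  fill cs (map g (map (fill cs vs) cs)) c  ≡⟨ cong (λ ws → fill cs ws c) (sym (map-∘ cs)) ⟩
  fill cs (map (g ∘ fill cs vs) cs) c      ≡⟨ fill-map (g ∘ fill cs vs) cs c∈ ⟩
  g (fill cs vs c)                         ∎
  where open ≡-Reasoning

-- Tableaux and standardisation

cell-≟ : (c d : Cell) → Dec (c ≡ d)
cell-≟ = ≡-dec _≟_ _≟_

module Tableaux (cs : List Cell) (cs-unique : Unique cs) (cs-closed : RectangleClosed cs) where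

  n : ℕ
  n = length cs

  record Semistandard (X : Cell → ℕ) (M : ℕ) : Set where
    field
      bounded     : ∀ {c} → c ∈ cs → 1 ≤ X c × X c ≤ M
      rows-weak   : ∀ {c d} → c ∈ cs → d ∈ cs → row c ≡ row d → col c < col d → X c ≤ X d
      cols-strict : ∀ {c d} → c ∈ cs → d ∈ cs → col c ≡ col d → row c < row d → X c < X d

  semistandard-cong : ∀ {X Y M} → (∀ {c} → c ∈ cs → X c ≡ Y c) → Semistandard X M → Semistandard Y M
  semistandard-cong {M = M} X≡Y ss = record
    { bounded     = λ c∈ → subst (λ z → 1 ≤ z × z ≤ M) (X≡Y c∈) (bounded c∈)
    ; rows-weak   = λ c∈ d∈ r≡ col< → subst₂ _≤_ (X≡Y c∈) (X≡Y d∈) (rows-weak c∈ d∈ r≡ col<)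
    ; cols-strict = λ c∈ d∈ col≡ r< → subst₂ _<_ (X≡Y c∈) (X≡Y d∈) (cols-strict c∈ d∈ col≡ r<)
    }
    where open Semistandard ss

  module _ (X : Cell → ℕ) (M : ℕ) where

    private
      inRange : Cell → Bool
      inRange c = (1 ≤ᵇ X c) ∧ (X c ≤ᵇ M)

      ordered : Cell → Cell → Bool
      ordered c d = (not ((row c ≡ᵇ row d) ∧ (col c <ᵇ col d)) ∨ (X c ≤ᵇ X d)) ∧
                    (not ((col c ≡ᵇ col d) ∧ (row c <ᵇ row d)) ∨ (X c <ᵇ X d))

    semistandard⁻ : semistandard cs X M ≡ true → Semistandard X M
    semistandard⁻ h = record { bounded = bounded′ ; rows-weak = rows-weak′ ; cols-strict = cols-strict′ }
      where
      parts : all inRange cs ≡ true × all (λ c → all (ordered c) cs) cs ≡ true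
      parts = ∧-true⁻ h
      ordered-pair : ∀ {c d} → c ∈ cs → d ∈ cs → ordered c d ≡ true
      ordered-pair {c} c∈ d∈ = all-true⁻ (ordered c) cs (all-true⁻ (λ c → all (ordered c) cs) cs (proj₂ parts) c∈) d∈
      bounded′ : ∀ {c} → c ∈ cs → 1 ≤ X c × X c ≤ M
      bounded′ {c} c∈ = let lo , hi = ∧-true⁻ (all-true⁻ inRange cs (proj₁ parts) c∈) in
        ≤ᵇ-true⇒≤ 1 (X c) lo , ≤ᵇ-true⇒≤ (X c) M hi
      rows-weak′ : ∀ {c d} → c ∈ cs → d ∈ cs → row c ≡ row d → col c < col d → X c ≤ X d
      rows-weak′ {c} {d} c∈ d∈ r≡ c< =
        ≤ᵇ-true⇒≤ (X c) (X d) (⇒-true⁻ (proj₁ (∧-true⁻ (ordered-pair c∈ d∈))) (∧-true⁺ (≡⇒≡ᵇ-true _ _ r≡) (<⇒<ᵇ-true c<)))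
      cols-strict′ : ∀ {c d} → c ∈ cs → d ∈ cs → col c ≡ col d → row c < row d → X c < X d
      cols-strict′ {c} {d} c∈ d∈ c≡ r< =
        <ᵇ-true⇒< (X c) (X d) (⇒-true⁻ (proj₂ (∧-true⁻ (ordered-pair c∈ d∈))) (∧-true⁺ (≡⇒≡ᵇ-true _ _ c≡) (<⇒<ᵇ-true r<)))

    semistandard⁺ : Semistandard X M → semistandard cs X M ≡ true
    semistandard⁺ ss = ∧-true⁺ (all-true⁺ inRange cs in-range) (all-true⁺ _ cs λ c∈ → all-true⁺ _ cs λ d∈ → pair-ordered c∈ d∈)
      where
      open Semistandard ss
      in-range : ∀ {c} → c ∈ cs → inRange c ≡ true
      in-range c∈ = ∧-true⁺ (≤⇒≤ᵇ-true (proj₁ (bounded c∈))) (≤⇒≤ᵇ-true (proj₂ (bounded c∈)))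
      pair-ordered : ∀ {c d} → c ∈ cs → d ∈ cs → ordered c d ≡ true
      pair-ordered c∈ d∈ = ∧-true⁺
        (⇒-true⁺ _ _ λ h → let r≡ , c< = ∧-true⁻ h in ≤⇒≤ᵇ-true (rows-weak c∈ d∈ (≡ᵇ-true⇒≡ _ _ r≡) (<ᵇ-true⇒< _ _ c<)))
        (⇒-true⁺ _ _ λ h → let c≡ , r< = ∧-true⁻ h in <⇒<ᵇ-true (cols-strict c∈ d∈ (≡ᵇ-true⇒≡ _ _ c≡) (<ᵇ-true⇒< _ _ r<)))

  Precedes : (Cell → ℕ) → Cell → Cell → Set
  Precedes X d c = X d < X c ⊎ (X d ≡ X c × col d < col c)

  precedesᵇ : (Cell → ℕ) → Cell → Cell → Bool
  precedesᵇ X d c = (X d <ᵇ X c) ∨ ((X d ≡ᵇ X c) ∧ (col d <ᵇ col c))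

  precedesᵇ-true⇒ : ∀ X d c → precedesᵇ X d c ≡ true → Precedes X d c
  precedesᵇ-true⇒ X d c h with ∨-true⁻ {X d <ᵇ X c} h
  ... | inj₁ lt = inj₁ (<ᵇ-true⇒< _ _ lt)
  ... | inj₂ eq = let X≡ , col< = ∧-true⁻ eq in inj₂ (≡ᵇ-true⇒≡ _ _ X≡ , <ᵇ-true⇒< _ _ col<)

  ⇒precedesᵇ-true : ∀ X d c → Precedes X d c → precedesᵇ X d c ≡ true
  ⇒precedesᵇ-true X d c (inj₁ lt)          = ∨-trueˡ _ (<⇒<ᵇ-true lt)
  ⇒precedesᵇ-true X d c (inj₂ (X≡ , col<)) = ∨-trueʳ (X d <ᵇ X c) (∧-true⁺ (≡⇒≡ᵇ-true _ _ X≡) (<⇒<ᵇ-true col<))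

  standardise : (Cell → ℕ) → Cell → ℕ
  standardise X c = suc (count (λ d → precedesᵇ X d c) cs)

  standardisation : List ℕ → List ℕ
  standardisation vs = map (standardise (fill cs vs)) cs

  standardise-cong : ∀ X Y → (∀ {c} → c ∈ cs → X c ≡ Y c) → ∀ {c} → c ∈ cs → standardise X c ≡ standardise Y c
  standardise-cong X Y X≡Y {c} c∈ =
    cong suc (count-cong _ _ cs λ {d} d∈ → cong₂ (λ a b → (a <ᵇ b) ∨ ((a ≡ᵇ b) ∧ (col d <ᵇ col c))) (X≡Y d∈) (X≡Y c∈))

  -- Definitionally the predicate filtered by `asc`.
  isAscent : (Cell → ℕ) → List Cell → ℕ → Bool
  isAscent S E k =
    any (λ c → any (λ d → (S c ≡ᵇ k) ∧ (S d ≡ᵇ suc k) ∧ (row c <ᵇ row d)) cs) cs ∨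
    any (λ d → any (λ e → (S d ≡ᵇ k) ∧ (S e ≡ᵇ suc k) ∧ (col d ≡ᵇ col e ∸ 1)) E) cs

  data Ascent (S : Cell → ℕ) (E : List Cell) (k : ℕ) : Set where
    lower-row : ∀ {c d} → c ∈ cs → d ∈ cs → S c ≡ k → S d ≡ suc k → row c < row d → Ascent S E k
    starred   : ∀ {d e} → d ∈ cs → e ∈ E → S d ≡ k → S e ≡ suc k → col d ≡ col e ∸ 1 → Ascent S E k

  isAscent⁻ : ∀ S E k → isAscent S E k ≡ true → Ascent S E k
  isAscent⁻ S E k h with ∨-true⁻ {any (λ c → any (λ d → (S c ≡ᵇ k) ∧ (S d ≡ᵇ suc k) ∧ (row c <ᵇ row d)) cs) cs} h
  ... | inj₁ h₁ = let c , c∈ , h₂ = any-true⁻ _ cs h₁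
                      d , d∈ , h₃ = any-true⁻ _ cs h₂
                      Sc≡ , h₄ = ∧-true⁻ h₃
                      Sd≡ , r< = ∧-true⁻ h₄
                  in lower-row c∈ d∈ (≡ᵇ-true⇒≡ _ _ Sc≡) (≡ᵇ-true⇒≡ _ _ Sd≡) (<ᵇ-true⇒< _ _ r<)
  ... | inj₂ h₁ = let d , d∈ , h₂ = any-true⁻ _ cs h₁
                      e , e∈ , h₃ = any-true⁻ _ E h₂
                      Sd≡ , h₄ = ∧-true⁻ h₃
                      Se≡ , col≡ = ∧-true⁻ h₄
                  in starred d∈ e∈ (≡ᵇ-true⇒≡ _ _ Sd≡) (≡ᵇ-true⇒≡ _ _ Se≡) (≡ᵇ-true⇒≡ _ _ col≡)

  isAscent⁺ : ∀ S E k → Ascent S E k → isAscent S E k ≡ true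
  isAscent⁺ S E k (lower-row c∈ d∈ Sc≡ Sd≡ r<) =
    ∨-trueˡ _ (any-true⁺ _ cs c∈ (any-true⁺ _ cs d∈ (∧-true⁺ (≡⇒≡ᵇ-true _ _ Sc≡) (∧-true⁺ (≡⇒≡ᵇ-true _ _ Sd≡) (<⇒<ᵇ-true r<)))))
  isAscent⁺ S E k (starred d∈ e∈ Sd≡ Se≡ col≡) =
    ∨-trueʳ _ (any-true⁺ _ cs d∈ (any-true⁺ _ E e∈
      (∧-true⁺ (≡⇒≡ᵇ-true _ _ Sd≡) (∧-true⁺ (≡⇒≡ᵇ-true _ _ Se≡) (≡⇒≡ᵇ-true _ _ col≡)))))

  -- The words w contributing to F_{Asc′(S, E)}: weakly increasing, strictly at every ascent.
  compatibleᵇ : (Cell → ℕ) → List Cell → List ℕ → Bool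
  compatibleᵇ S E w = all (λ j → at w j ≤ᵇ at w (suc j)) (oneTo (n ∸ 1)) ∧ all (λ j → at w j <ᵇ at w (suc j)) (asc cs S E n)

  record Compatible (S : Cell → ℕ) (E : List Cell) (w : List ℕ) : Set where
    field
      weak   : ∀ {j} → 1 ≤ j → suc j ≤ n → at w j ≤ at w (suc j)
      strict : ∀ {j} → 1 ≤ j → suc j ≤ n → isAscent S E j ≡ true → at w j < at w (suc j)

  private
    below-pred : ∀ {j m} → suc j ≤ m → j ≤ m ∸ 1
    below-pred {m = suc m} (s≤s j≤m) = j≤m

    above-pred : ∀ {j m} → 1 ≤ j → j ≤ m ∸ 1 → suc j ≤ m
    above-pred {suc j} {suc m} _ j≤m = s≤s j≤m

  compatibleᵇ⁻ : ∀ S E w → compatibleᵇ S E w ≡ true → Compatible S E w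
  compatibleᵇ⁻ S E w h = record
    { weak   = λ 1≤j j<n → ≤ᵇ-true⇒≤ _ _ (all-true⁻ _ (oneTo (n ∸ 1)) (proj₁ parts) (∈-oneTo⁺ 1≤j (below-pred j<n)))
    ; strict = λ 1≤j j<n asc-j → <ᵇ-true⇒< _ _
        (all-true⁻ _ (asc cs S E n) (proj₂ parts) (∈-filterᵇ⁺ (isAscent S E) (∈-oneTo⁺ 1≤j (below-pred j<n)) asc-j))
    }
    where
    parts : all (λ j → at w j ≤ᵇ at w (suc j)) (oneTo (n ∸ 1)) ≡ true × all (λ j → at w j <ᵇ at w (suc j)) (asc cs S E n) ≡ true
    parts = ∧-true⁻ h

  compatibleᵇ⁺ : ∀ S E w → Compatible S E w → compatibleᵇ S E w ≡ true
  compatibleᵇ⁺ S E w cw = ∧-true⁺ (all-true⁺ _ (oneTo (n ∸ 1)) weak-at) (all-true⁺ _ (asc cs S E n) strict-at)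
    where
    open Compatible cw
    weak-at : ∀ {j} → j ∈ oneTo (n ∸ 1) → (at w j ≤ᵇ at w (suc j)) ≡ true
    weak-at j∈ with 1≤j , j≤ ← ∈-oneTo⁻ j∈ = ≤⇒≤ᵇ-true (weak 1≤j (above-pred 1≤j j≤))
    strict-at : ∀ {j} → j ∈ asc cs S E n → (at w j <ᵇ at w (suc j)) ≡ true
    strict-at j∈ with j∈′ , asc-j ← ∈-filterᵇ⁻ (isAscent S E) j∈ with 1≤j , j≤ ← ∈-oneTo⁻ j∈′ =
      <⇒<ᵇ-true (strict 1≤j (above-pred 1≤j j≤) asc-j)

  special⁻ : ∀ X {e} → special cs X e ≡ true → 1 < col e × (∀ {d} → d ∈ cs → col d ≡ col e ∸ 1 → X d ≢ X e)
  special⁻ X {e} h with 1<col , no-equal ← ∧-true⁻ h = <ᵇ-true⇒< _ _ 1<col , λ d∈ col≡ X≡ →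
    contradiction (subst (λ b → not b ≡ true) (any-true⁺ _ cs d∈ (∧-true⁺ (≡⇒≡ᵇ-true _ _ col≡) (≡⇒≡ᵇ-true _ _ X≡))) no-equal) λ ()

  special-false⁻ : ∀ X {e} → 1 < col e → special cs X e ≡ false → ∃[ d ] (d ∈ cs × col d ≡ col e ∸ 1 × X d ≡ X e)
  special-false⁻ X {e} 1<col h with any (λ d → (col d ≡ᵇ col e ∸ 1) ∧ (X d ≡ᵇ X e)) cs in found
  ... | true  = let d , d∈ , h′ = any-true⁻ _ cs found
                    col≡ , X≡ = ∧-true⁻ h′
                in d , d∈ , ≡ᵇ-true⇒≡ _ _ col≡ , ≡ᵇ-true⇒≡ _ _ X≡
  ... | false rewrite <⇒<ᵇ-true 1<col with h
  ...   | ()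

  module Standard (s : List ℕ) (s-word : IsWord n n s) (s-ss : semistandard cs (fill cs s) n ≡ true)
                  (s-bij : isBijection s n ≡ true) where

    S : Cell → ℕ
    S = fill cs s

    open Semistandard (semistandard⁻ S n s-ss) public
      renaming (bounded to S-bounded; rows-weak to S-rows-weak; cols-strict to S-cols-strict)

    s≡map-S : s ≡ map S cs
    s≡map-S = values≡map-fill cs s cs-unique (proj₁ s-word)

    s-letters : Letters n s
    s-letters = proj₂ s-word

    s-once : OccursOnce n s
    s-once 1≤k k≤n = ≡ᵇ-true⇒≡ _ 1 (all-true⁻ (λ k → count (_≡ᵇ k) s ≡ᵇ 1) (oneTo n) s-bij (∈-oneTo⁺ 1≤k k≤n))

    count-S≡ : ∀ {k} → 1 ≤ k → k ≤ n → count (λ d → S d ≡ᵇ k) cs ≡ 1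
    count-S≡ {k} 1≤k k≤n = trans (sym (count-map (_≡ᵇ k) S cs)) (trans (cong (multiplicity k) (sym s≡map-S)) (s-once 1≤k k≤n))

    S-injective : ∀ {c d} → c ∈ cs → d ∈ cs → S c ≡ S d → c ≡ d
    S-injective {c} c∈ d∈ Sc≡Sd =
      count≤1⇒unique (λ x → S x ≡ᵇ S c) cs (≤-reflexive (count-S≡ (proj₁ (S-bounded c∈)) (proj₂ (S-bounded c∈))))
                      c∈ d∈ (≡⇒≡ᵇ-true (S c) (S c) refl) (≡⇒≡ᵇ-true _ _ (sym Sc≡Sd))

    cellOf : ℕ → Cell
    cellOf k = findOr (λ c → S c ≡ᵇ k) (0 , 0) cs

    cellOf-spec : ∀ {k} → 1 ≤ k → k ≤ n → cellOf k ∈ cs × S (cellOf k) ≡ k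
    cellOf-spec {k} 1≤k k≤n with c , c∈ , Sc≡k ← count>0⇒∃ (λ c → S c ≡ᵇ k) cs (subst (0 <_) (sym (count-S≡ 1≤k k≤n)) (s≤s z≤n)) =
      let found∈ , found = findOr-spec (λ c → S c ≡ᵇ k) (0 , 0) cs c∈ Sc≡k in found∈ , ≡ᵇ-true⇒≡ _ _ found

    cellOf-S : ∀ {c} → c ∈ cs → cellOf (S c) ≡ c
    cellOf-S c∈ = let found∈ , found = cellOf-spec (proj₁ (S-bounded c∈)) (proj₂ (S-bounded c∈)) in S-injective found∈ c∈ found

    -- The word w with vs = w ∘ S.
    readWord : List ℕ → List ℕ
    readWord vs = map (λ k → fill cs vs (cellOf k)) (oneTo n)

    rank : ∀ {c} → c ∈ cs → count (λ d → S d <ᵇ S c) cs ≡ S c ∸ 1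
    rank {c} c∈ = begin
      count (λ d → S d <ᵇ S c) cs  ≡⟨ sym (count-map (_<ᵇ S c) S cs) ⟩
      count (_<ᵇ S c) (map S cs)   ≡⟨ cong (count (_<ᵇ S c)) (sym s≡map-S) ⟩
      count (_<ᵇ S c) s            ≡⟨ count-<ᵇ-occursOnce s s-letters s-once (proj₁ (S-bounded c∈))
                                                           (m≤n⇒m≤1+n (proj₂ (S-bounded c∈))) ⟩
      S c ∸ 1                      ∎
      where open ≡-Reasoning

    nonFirstColumn-special : ∀ {c} → c ∈ cs → 1 < col c → special cs S c ≡ true
    nonFirstColumn-special {c} c∈ 1<col = ∧-true⁺ (<⇒<ᵇ-true 1<col) (cong not (any-false⁺ _ cs no-equal))
      where
      no-equal : ∀ {d} → d ∈ cs → ((col d ≡ᵇ col c ∸ 1) ∧ (S d ≡ᵇ S c)) ≡ false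
      no-equal {d} d∈ = ≢true⇒≡false λ h → let col≡ , S≡ = ∧-true⁻ h in
        <-irrefl (sym (trans (cong col (sym (S-injective d∈ c∈ (≡ᵇ-true⇒≡ _ _ S≡)))) (≡ᵇ-true⇒≡ _ _ col≡))) (pred-< 1<col)
        where
        pred-< : ∀ {m} → 1 < m → m ∸ 1 < m
        pred-< {suc m} _ = n<1+n m

    module Destandardise (w : List ℕ) (N : ℕ) (w-word : IsWord n N w) (E : List Cell) (w-compatible : Compatible S E w) where

      open Compatible w-compatible

      Tw : Cell → ℕ
      Tw c = at w (S c)

      weak-range : ∀ {a} k → 1 ≤ a → a + k ≤ n → at w a ≤ at w (a + k)
      weak-range {a} zero    _   _     = ≤-reflexive (cong (at w) (sym (+-identityʳ a)))
      weak-range {a} (suc k) 1≤a a+k<n = ≤-trans (weak-range k 1≤a (≤-trans (+-monoʳ-≤ a (n≤1+n k)) a+k<n))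
        (subst (λ z → at w (a + k) ≤ at w z) (sym (+-suc a k)) (weak (≤-trans 1≤a (m≤m+n a k)) (subst (_≤ n) (+-suc a k) a+k<n)))

      Tw-monotone : ∀ {c d} → c ∈ cs → d ∈ cs → S c ≤ S d → Tw c ≤ Tw d
      Tw-monotone {c} {d} c∈ d∈ Sc≤Sd = subst (λ z → Tw c ≤ at w z) (m+[n∸m]≡n Sc≤Sd)
        (weak-range (S d ∸ S c) (proj₁ (S-bounded c∈)) (subst (_≤ n) (sym (m+[n∸m]≡n Sc≤Sd)) (proj₂ (S-bounded d∈))))

      -- Moving to a lower row is an ascent, where w increases strictly.
      equal-step : ∀ {a} → 1 ≤ a → suc a ≤ n → at w a ≡ at w (suc a) → row (cellOf (suc a)) ≤ row (cellOf a)
      equal-step {a} 1≤a a<n eq with row (cellOf (suc a)) ≤? row (cellOf a)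
      ... | yes rises = rises
      ... | no falls  = contradiction eq (<⇒≢ (strict 1≤a a<n (isAscent⁺ S E a
                          (lower-row (proj₁ a-cell) (proj₁ sa-cell) (proj₂ a-cell) (proj₂ sa-cell) (≰⇒> falls)))))
        where
        a-cell : cellOf a ∈ cs × S (cellOf a) ≡ a
        a-cell = cellOf-spec 1≤a (≤-trans (n≤1+n a) a<n)
        sa-cell : cellOf (suc a) ∈ cs × S (cellOf (suc a)) ≡ suc a
        sa-cell = cellOf-spec (s≤s z≤n) a<n

      equal-run : ∀ {a} k → 1 ≤ a → a + k ≤ n → at w a ≡ at w (a + k) → row (cellOf (a + k)) ≤ row (cellOf a)
      equal-run {a} zero    _   _     _  = ≤-reflexive (cong (row ∘ cellOf) (+-identityʳ a))
      equal-run {a} (suc k) 1≤a a+k<n eq = ≤-trans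
        (subst (λ z → row (cellOf z) ≤ row (cellOf (suc a))) (sym (+-suc a k)) (equal-run k (s≤s z≤n) sa+k≤n rest-equal))
        (equal-step 1≤a sa≤n first-equal)
        where
        sa+k≤n : suc a + k ≤ n
        sa+k≤n = subst (_≤ n) (+-suc a k) a+k<n
        sa≤n : suc a ≤ n
        sa≤n = ≤-trans (m≤m+n (suc a) k) sa+k≤n
        first : at w a ≤ at w (suc a)
        first = weak 1≤a sa≤n
        rest : at w (suc a) ≤ at w (suc a + k)
        rest = weak-range k (s≤s z≤n) sa+k≤n
        back : at w (suc a + k) ≡ at w a
        back = trans (cong (at w) (sym (+-suc a k))) (sym eq)
        first-equal : at w a ≡ at w (suc a)
        first-equal = ≤-antisym first (≤-trans rest (≤-reflexive back))
        rest-equal : at w (suc a) ≡ at w (suc a + k)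
        rest-equal = ≤-antisym rest (≤-trans (≤-reflexive back) first)

      equal-letters-rows : ∀ {c d} → c ∈ cs → d ∈ cs → S c ≤ S d → Tw c ≡ Tw d → row d ≤ row c
      equal-letters-rows {c} {d} c∈ d∈ Sc≤Sd eq = subst₂ (λ x y → row x ≤ row y) d-cell (cellOf-S c∈)
        (equal-run (S d ∸ S c) (proj₁ (S-bounded c∈)) (subst (_≤ n) (sym Sc+k≡Sd) (proj₂ (S-bounded d∈)))
                   (trans eq (cong (at w) (sym Sc+k≡Sd))))
        where
        Sc+k≡Sd : S c + (S d ∸ S c) ≡ S d
        Sc+k≡Sd = m+[n∸m]≡n Sc≤Sd
        d-cell : cellOf (S c + (S d ∸ S c)) ≡ d
        d-cell = trans (cong cellOf Sc+k≡Sd) (cellOf-S d∈)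

      Tw-semistandard : Semistandard Tw N
      Tw-semistandard = record
        { bounded     = λ c∈ → All.lookup (proj₂ w-word)
                          (at-∈ w (proj₁ (S-bounded c∈)) (subst (_ ≤_) (sym (proj₁ w-word)) (proj₂ (S-bounded c∈))))
        ; rows-weak   = λ c∈ d∈ r≡ c< → Tw-monotone c∈ d∈ (S-rows-weak c∈ d∈ r≡ c<)
        ; cols-strict = λ c∈ d∈ c≡ r< → let Sc<Sd = S-cols-strict c∈ d∈ c≡ r< in
                          ≤∧≢⇒< (Tw-monotone c∈ d∈ (<⇒≤ Sc<Sd)) (λ eq → <⇒≱ r< (equal-letters-rows c∈ d∈ (<⇒≤ Sc<Sd) eq))
        }

      open Semistandard Tw-semistandard using () renaming (rows-weak to Tw-rows-weak; cols-strict to Tw-cols-strict)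

      Tw<⇒S< : ∀ {c d} → c ∈ cs → d ∈ cs → Tw d < Tw c → S d < S c
      Tw<⇒S< c∈ d∈ lt = ≰⇒> λ Sc≤Sd → <⇒≱ lt (Tw-monotone c∈ d∈ Sc≤Sd)

      Tw≡⇒S< : ∀ {c d} → c ∈ cs → d ∈ cs → Tw d ≡ Tw c → col d < col c → S d < S c
      Tw≡⇒S< {c} {d} c∈ d∈ eq cd<cc = ≰⇒> λ Sc≤Sd → case (m≤n⇒m<n∨m≡n (equal-letters-rows c∈ d∈ Sc≤Sd (sym eq))) Sc≤Sd
        where
        case : row d < row c ⊎ row d ≡ row c → S c ≤ S d → ⊥
        case (inj₁ rd<rc) _     = <-irrefl eq (≤-<-trans (Tw-rows-weak d∈ e∈ refl cd<cc) (Tw-cols-strict e∈ c∈ refl rd<rc))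
          where
          e∈ : (row d , col c) ∈ cs
          e∈ = cs-closed d∈ c∈ rd<rc (<⇒≤ cd<cc)
        case (inj₂ rd≡rc) Sc≤Sd = <-irrefl (cong col (S-injective d∈ c∈ (≤-antisym (S-rows-weak d∈ c∈ rd≡rc cd<cc) Sc≤Sd))) cd<cc

      precedes⇒S< : ∀ {c d} → c ∈ cs → d ∈ cs → Precedes Tw d c → S d < S c
      precedes⇒S< c∈ d∈ (inj₁ lt)          = Tw<⇒S< c∈ d∈ lt
      precedes⇒S< c∈ d∈ (inj₂ (eq , col<)) = Tw≡⇒S< c∈ d∈ eq col<

      S<⇒precedes : ∀ {c d} → c ∈ cs → d ∈ cs → S d < S c → Precedes Tw d c
      S<⇒precedes {c} {d} c∈ d∈ lt with <-cmp (Tw d) (Tw c)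
      ... | tri< Tw< _ _ = inj₁ Tw<
      ... | tri> _ _ Tw> = contradiction lt (<-asym (Tw<⇒S< d∈ c∈ Tw>))
      ... | tri≈ _ Tw≡ _ with <-cmp (col d) (col c)
      ...   | tri< col< _ _ = inj₂ (Tw≡ , col<)
      ...   | tri> _ _ col> = contradiction lt (<-asym (Tw≡⇒S< d∈ c∈ (sym Tw≡) col>))
      ...   | tri≈ _ col≡ _ with <-cmp (row d) (row c)
      ...     | tri< row< _ _ = contradiction Tw≡ (<⇒≢ (Tw-cols-strict d∈ c∈ col≡ row<))
      ...     | tri> _ _ row> = contradiction (sym Tw≡) (<⇒≢ (Tw-cols-strict c∈ d∈ (sym col≡) row>))
      ...     | tri≈ _ row≡ _ = contradiction (cong S (cong₂ _,_ row≡ col≡)) (<⇒≢ lt)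

      S≡standardise : ∀ {c} → c ∈ cs → S c ≡ standardise Tw c
      S≡standardise {c} c∈ = trans (sym (suc[m∸1]≡m (proj₁ (S-bounded c∈)))) (cong suc (trans (sym (rank c∈))
        (count-cong _ _ cs λ {d} d∈ → bool-ext _ _
          (λ h → ⇒precedesᵇ-true Tw d c (S<⇒precedes c∈ d∈ (<ᵇ-true⇒< _ _ h)))
          (λ h → <⇒<ᵇ-true (precedes⇒S< c∈ d∈ (precedesᵇ-true⇒ Tw d c h))))))


      destandardised : List ℕ
      destandardised = map (at w) s

      fill-destandardised : ∀ {c} → c ∈ cs → fill cs destandardised c ≡ Tw c
      fill-destandardised = fill-map-values (at w) cs s cs-unique (proj₁ s-word)

      destandardised-word : IsWord n N destandardised
      destandardised-word = trans (length-map (at w) s) (proj₁ s-word) , AllProperties.map⁺ (All.map letter s-letters)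
        where
        letter : ∀ {v} → 1 ≤ v × v ≤ n → 1 ≤ at w v × at w v ≤ N
        letter {v} (1≤v , v≤n) = All.lookup (proj₂ w-word) (at-∈ w 1≤v (subst (v ≤_) (sym (proj₁ w-word)) v≤n))

      destandardised-semistandard : semistandard cs (fill cs destandardised) N ≡ true
      destandardised-semistandard = semistandard⁺ _ N (semistandard-cong (sym ∘ fill-destandardised) Tw-semistandard)

      s≡standardisation : s ≡ standardisation destandardised
      s≡standardisation = trans s≡map-S (map-cong-local (All.tabulate λ c∈ →
        trans (S≡standardise c∈) (standardise-cong Tw (fill cs destandardised) (sym ∘ fill-destandardised) c∈)))

      w≡readWord : w ≡ readWord destandardised
      w≡readWord = begin
        w                                  ≡⟨ sym (map-at-oneTo w) ⟩
        map (at w) (oneTo (length w))      ≡⟨ cong (λ m → map (at w) (oneTo m)) (proj₁ w-word) ⟩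
        map (at w) (oneTo n)               ≡⟨ map-cong-local (All.tabulate letter) ⟩
        readWord destandardised            ∎
        where
        open ≡-Reasoning
        letter : ∀ {k} → k ∈ oneTo n → at w k ≡ fill cs destandardised (cellOf k)
        letter k∈ = let 1≤k , k≤n = ∈-oneTo⁻ k∈
                        cell∈ , S≡k = cellOf-spec 1≤k k≤n
                    in sym (trans (fill-destandardised cell∈) (cong (at w) S≡k))

  module Standardisation (vs : List ℕ) (N : ℕ) (vs-word : IsWord n N vs) (vs-ss : semistandard cs (fill cs vs) N ≡ true) where

    T : Cell → ℕ
    T = fill cs vs

    open Semistandard (semistandard⁻ T N vs-ss)
      renaming (bounded to T-bounded; rows-weak to T-rows-weak; cols-strict to T-cols-strict)

    precedes-irrefl : ∀ {c} → ¬ Precedes T c c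
    precedes-irrefl (inj₁ lt)      = <-irrefl refl lt
    precedes-irrefl (inj₂ (_ , lt)) = <-irrefl refl lt

    precedesᵇ-irrefl : ∀ c → precedesᵇ T c c ≡ false
    precedesᵇ-irrefl c = ≢true⇒≡false (precedes-irrefl ∘ precedesᵇ-true⇒ T c c)

    precedes-trans : ∀ {a b c} → Precedes T a b → Precedes T b c → Precedes T a c
    precedes-trans (inj₁ lt)         (inj₁ lt′)         = inj₁ (<-trans lt lt′)
    precedes-trans (inj₁ lt)         (inj₂ (eq′ , _))   = inj₁ (<-≤-trans lt (≤-reflexive eq′))
    precedes-trans (inj₂ (eq , _))   (inj₁ lt′)         = inj₁ (≤-<-trans (≤-reflexive eq) lt′)
    precedes-trans (inj₂ (eq , col<)) (inj₂ (eq′ , col<′)) = inj₂ (trans eq eq′ , <-trans col< col<′)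

    precedes⇒≤ : ∀ {a b} → Precedes T a b → T a ≤ T b
    precedes⇒≤ (inj₁ lt)      = <⇒≤ lt
    precedes⇒≤ (inj₂ (eq , _)) = ≤-reflexive eq

    precedes-total : ∀ {c d} → c ∈ cs → d ∈ cs → c ≢ d → Precedes T c d ⊎ Precedes T d c
    precedes-total {c} {d} c∈ d∈ c≢d with <-cmp (T c) (T d)
    ... | tri< lt _ _ = inj₁ (inj₁ lt)
    ... | tri> _ _ gt = inj₂ (inj₁ gt)
    ... | tri≈ _ eq _ with <-cmp (col c) (col d)
    ...   | tri< col< _ _ = inj₁ (inj₂ (eq , col<))
    ...   | tri> _ _ col> = inj₂ (inj₂ (sym eq , col>))
    ...   | tri≈ _ col≡ _ with <-cmp (row c) (row d)
    ...     | tri< row< _ _ = contradiction eq (<⇒≢ (T-cols-strict c∈ d∈ col≡ row<))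
    ...     | tri> _ _ row> = contradiction (sym eq) (<⇒≢ (T-cols-strict d∈ c∈ (sym col≡) row>))
    ...     | tri≈ _ row≡ _ = contradiction (cong₂ _,_ row≡ col≡) c≢d

    R : Cell → ℕ
    R = standardise T

    R-strict : ∀ {c d} → d ∈ cs → Precedes T d c → R d < R c
    R-strict {c} {d} d∈ d≺c = s≤s (count-mono-< (λ f → precedesᵇ T f d) (λ f → precedesᵇ T f c) cs
      (λ {f} _ h → ⇒precedesᵇ-true T f c (precedes-trans (precedesᵇ-true⇒ T f d h) d≺c))
      d∈ (precedesᵇ-irrefl d) (⇒precedesᵇ-true T d c d≺c))

    R<⇒precedes : ∀ {c d} → c ∈ cs → d ∈ cs → R d < R c → Precedes T d c
    R<⇒precedes {c} {d} c∈ d∈ lt with cell-≟ c d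
    ... | yes refl = contradiction lt (<-irrefl refl)
    ... | no c≢d with precedes-total c∈ d∈ c≢d
    ...   | inj₁ c≺d = contradiction lt (<-asym (R-strict c∈ c≺d))
    ...   | inj₂ d≺c = d≺c

    R-injective : ∀ {c d} → c ∈ cs → d ∈ cs → R c ≡ R d → c ≡ d
    R-injective {c} {d} c∈ d∈ eq with cell-≟ c d
    ... | yes c≡d = c≡d
    ... | no c≢d with precedes-total c∈ d∈ c≢d
    ...   | inj₁ c≺d = contradiction eq (<⇒≢ (R-strict c∈ c≺d))
    ...   | inj₂ d≺c = contradiction (sym eq) (<⇒≢ (R-strict d∈ d≺c))

    R-bounded : ∀ {c} → c ∈ cs → 1 ≤ R c × R c ≤ n
    R-bounded {c} c∈ = s≤s z≤n , count<length (λ d → precedesᵇ T d c) cs c∈ (precedesᵇ-irrefl c)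

    R-semistandard : Semistandard R n
    R-semistandard = record
      { bounded     = R-bounded
      ; rows-weak   = λ {c} {d} c∈ d∈ r≡ col< → case (<-cmp (T c) (T d)) c∈ d∈ r≡ col<
      ; cols-strict = λ c∈ d∈ col≡ r< → R-strict c∈ (inj₁ (T-cols-strict c∈ d∈ col≡ r<))
      }
      where
      case : ∀ {c d} → Tri (T c < T d) (T c ≡ T d) (T d < T c) →
             c ∈ cs → d ∈ cs → row c ≡ row d → col c < col d → R c ≤ R d
      case (tri< lt _ _) c∈ _  _  _    = <⇒≤ (R-strict c∈ (inj₁ lt))
      case (tri≈ _ eq _) c∈ _  _  col< = <⇒≤ (R-strict c∈ (inj₂ (eq , col<)))
      case (tri> _ _ gt) c∈ d∈ r≡ col< = contradiction (T-rows-weak c∈ d∈ r≡ col<) (<⇒≱ gt)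

    s₀ : List ℕ
    s₀ = standardisation vs

    S₀ : Cell → ℕ
    S₀ = fill cs s₀

    S₀≡R : ∀ {c} → c ∈ cs → S₀ c ≡ R c
    S₀≡R = fill-map R cs

    s₀-word : IsWord n n s₀
    s₀-word = length-map R cs , AllProperties.map⁺ (All.tabulate R-bounded)

    s₀-semistandard : semistandard cs S₀ n ≡ true
    s₀-semistandard = semistandard⁺ S₀ n (semistandard-cong (sym ∘ S₀≡R) R-semistandard)

    s₀-bijection : isBijection s₀ n ≡ true
    s₀-bijection = all-true⁺ _ (oneTo n) λ k∈ → let 1≤k , k≤n = ∈-oneTo⁻ k∈ in
      ≡⇒≡ᵇ-true _ 1 (pigeonhole s₀ (proj₁ s₀-word) (proj₂ s₀-word) at-most-once 1≤k k≤n)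
      where
      at-most-once : AtMostOnce s₀
      at-most-once k = subst (_≤ 1) (sym (count-map (_≡ᵇ k) R cs)) (count≤1 (λ c → R c ≡ᵇ k) cs cs-unique
        λ {a} {b} a∈ b∈ Ra≡k Rb≡k → R-injective a∈ b∈ (trans (≡ᵇ-true⇒≡ (R a) k Ra≡k) (sym (≡ᵇ-true⇒≡ (R b) k Rb≡k))))

    module S₀ = Standard s₀ s₀-word s₀-semistandard s₀-bijection

    w₀ : List ℕ
    w₀ = S₀.readWord vs

    at-w₀ : ∀ {k} → 1 ≤ k → k ≤ n → at w₀ k ≡ T (S₀.cellOf k)
    at-w₀ = at-map-oneTo (λ k → T (S₀.cellOf k)) n

    at-w₀-S₀ : ∀ {c j} → c ∈ cs → S₀ c ≡ j → at w₀ j ≡ T c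
    at-w₀-S₀ {c} c∈ refl = trans (at-w₀ (proj₁ (S₀.S-bounded c∈)) (proj₂ (S₀.S-bounded c∈))) (cong T (S₀.cellOf-S c∈))

    at-w₀-R : ∀ {c} → c ∈ cs → at w₀ (R c) ≡ T c
    at-w₀-R c∈ = at-w₀-S₀ c∈ (S₀≡R c∈)

    w₀-word : IsWord n N w₀
    w₀-word = trans (length-map _ (oneTo n)) (length-oneTo n) , AllProperties.map⁺ (All.tabulate letter)
      where
      letter : ∀ {k} → k ∈ oneTo n → 1 ≤ T (S₀.cellOf k) × T (S₀.cellOf k) ≤ N
      letter k∈ = let 1≤k , k≤n = ∈-oneTo⁻ k∈ in T-bounded (proj₁ (S₀.cellOf-spec 1≤k k≤n))

    w₀∘s₀≡vs : map (at w₀) s₀ ≡ vs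
    w₀∘s₀≡vs = trans (sym (map-∘ cs))
      (trans (map-cong-local (All.tabulate at-w₀-R)) (sym (values≡map-fill cs vs cs-unique (proj₁ vs-word))))

    consecutive : ∀ {c d j} → c ∈ cs → d ∈ cs → S₀ c ≡ j → S₀ d ≡ suc j → Precedes T c d
    consecutive c∈ d∈ S₀c≡j S₀d≡sj =
      R<⇒precedes d∈ c∈ (subst₂ _<_ (trans (sym S₀c≡j) (S₀≡R c∈)) (trans (sym S₀d≡sj) (S₀≡R d∈)) (n<1+n _))

    w₀-weak : ∀ {j} → 1 ≤ j → suc j ≤ n → at w₀ j ≤ at w₀ (suc j)
    w₀-weak 1≤j j<n with c∈ , S₀c≡j ← S₀.cellOf-spec 1≤j (≤-trans (n≤1+n _) j<n) | d∈ , S₀d≡sj ← S₀.cellOf-spec (s≤s z≤n) j<n =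
      subst₂ _≤_ (sym (at-w₀-S₀ c∈ S₀c≡j)) (sym (at-w₀-S₀ d∈ S₀d≡sj)) (precedes⇒≤ (consecutive c∈ d∈ S₀c≡j S₀d≡sj))

    T-strict-down : ∀ {c d} → c ∈ cs → d ∈ cs → Precedes T c d → row c < row d → T c < T d
    T-strict-down c∈ d∈ (inj₁ lt)          _  = lt
    T-strict-down {c} {d} c∈ d∈ (inj₂ (eq , col<)) r< =
      contradiction eq (<⇒≢ (≤-<-trans (T-rows-weak c∈ e∈ refl col<) (T-cols-strict e∈ d∈ refl r<)))
      where
      e∈ : (row c , col d) ∈ cs
      e∈ = cs-closed c∈ d∈ r< (<⇒≤ col<)

    w₀-compatible : ∀ E → All (_∈ cs) E → all (special cs T) E ≡ true → Compatible S₀ E w₀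
    w₀-compatible E E⊆cs E-special = record { weak = w₀-weak ; strict = strict }
      where
      strict : ∀ {j} → 1 ≤ j → suc j ≤ n → isAscent S₀ E j ≡ true → at w₀ j < at w₀ (suc j)
      strict _ _ asc-j with isAscent⁻ S₀ E _ asc-j
      ... | lower-row c∈ d∈ S₀c≡j S₀d≡sj r< = subst₂ _<_ (sym (at-w₀-S₀ c∈ S₀c≡j)) (sym (at-w₀-S₀ d∈ S₀d≡sj))
                                                 (T-strict-down c∈ d∈ (consecutive c∈ d∈ S₀c≡j S₀d≡sj) r<)
      ... | starred {e = e} d∈ e∈E S₀d≡j S₀e≡sj col≡ = subst₂ _<_ (sym (at-w₀-S₀ d∈ S₀d≡j)) (sym (at-w₀-S₀ e∈ S₀e≡sj))
              (≤∧≢⇒< (precedes⇒≤ (consecutive d∈ e∈ S₀d≡j S₀e≡sj)) (proj₂ (special⁻ T (all-true⁻ _ E E-special e∈E)) d∈ col≡))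
        where
        e∈ : e ∈ cs
        e∈ = All.lookup E⊆cs e∈E

    R-next : ∀ {d e} → d ∈ cs → col d ≡ col e ∸ 1 → 1 < col e → T d ≡ T e → R e ≡ suc (R d)
    R-next {d} {e} d∈ col≡ 1<col Td≡Te = cong suc (trans
      (count-+ (λ f → precedesᵇ T f d) (λ f → sameCell f d) (λ f → precedesᵇ T f e) cs λ f∈ → split f∈)
      (trans (cong (count (λ f → precedesᵇ T f d) cs +_) one-d) (+-comm _ 1)))
      where
      col-e : col e ≡ suc (col d)
      col-e = trans (sym (suc[m∸1]≡m (<⇒≤ 1<col))) (cong suc (sym col≡))
      d≺e : Precedes T d e
      d≺e = inj₂ (Td≡Te , subst (col d <_) (sym col-e) (n<1+n _))
      one-d : count (λ f → sameCell f d) cs ≡ 1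
      one-d = count≡1 (λ f → sameCell f d) cs cs-unique d∈ (sameCell-refl d) λ _ → sameCell-true⇒≡
      nothing-between : ∀ {f} → Precedes T d f → Precedes T f e → ⊥
      nothing-between (inj₁ lt)           f≺e                  = <-irrefl refl (<-≤-trans lt (≤-trans (precedes⇒≤ f≺e) (≤-reflexive (sym Td≡Te))))
      nothing-between (inj₂ (Td≡Tf , _))  (inj₁ lt)            = <-irrefl (trans (sym Td≡Tf) Td≡Te) lt
      nothing-between (inj₂ (_ , col<))   (inj₂ (_ , col<′))  = <-irrefl refl (<-≤-trans col< (≤-pred (subst (_ <_) col-e col<′)))
      split : ∀ {f} → f ∈ cs → indicator (precedesᵇ T f e) ≡ indicator (precedesᵇ T f d) + indicator (sameCell f d)
      split {f} f∈ with cell-≟ f d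
      ... | yes refl rewrite ⇒precedesᵇ-true T d e d≺e | precedesᵇ-irrefl d | sameCell-refl d = refl
      ... | no f≢d rewrite ≢⇒sameCell-false f≢d = trans (cong indicator (bool-ext _ _ before-e before-d)) (sym (+-identityʳ _))
        where
        before-e : precedesᵇ T f e ≡ true → precedesᵇ T f d ≡ true
        before-e h with precedes-total f∈ d∈ f≢d
        ... | inj₁ f≺d = ⇒precedesᵇ-true T f d f≺d
        ... | inj₂ d≺f = contradiction (precedesᵇ-true⇒ T f e h) (nothing-between d≺f)
        before-d : precedesᵇ T f d ≡ true → precedesᵇ T f e ≡ true
        before-d h = ⇒precedesᵇ-true T f e (precedes-trans (precedesᵇ-true⇒ T f d h) d≺e)

    w₀-compatible⁻ : ∀ E → All (λ e → e ∈ cs × 1 < col e) E → Compatible S₀ E w₀ → all (special cs T) E ≡ true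
    w₀-compatible⁻ E E-cells cw = all-true⁺ _ E special-e
      where
      open Compatible cw
      -- A non-special e has an equal entry d just to its left; then R e = R d + 1 is a starred ascent of w₀.
      special-e : ∀ {e} → e ∈ E → special cs T e ≡ true
      special-e {e} e∈E with special cs T e in sp | All.lookup E-cells e∈E
      ... | true  | _ = refl
      ... | false | e∈ , 1<col with d , d∈ , col≡ , Td≡Te ← special-false⁻ T 1<col sp =
        contradiction (subst₂ _<_ (at-w₀-R d∈) (trans (cong (at w₀) (sym Re≡)) (at-w₀-R e∈)) ascent) (<-irrefl Td≡Te)
        where
        Re≡ : R e ≡ suc (R d)
        Re≡ = R-next d∈ col≡ 1<col Td≡Te
        ascent : at w₀ (R d) < at w₀ (suc (R d))
        ascent = strict (proj₁ (R-bounded d∈)) (subst (_≤ n) Re≡ (proj₂ (R-bounded e∈)))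
                        (isAscent⁺ S₀ E (R d) (starred d∈ e∈E (S₀≡R d∈) (trans (S₀≡R e∈) Re≡) col≡))

    special-T⇒S₀ : ∀ {c} → c ∈ cs → special cs T c ≡ true → special cs S₀ c ≡ true
    special-T⇒S₀ c∈ h = S₀.nonFirstColumn-special c∈ (proj₁ (special⁻ T h))

    wt-S₀≡wt-T : ∀ mu {e} → e ∈ cs → special cs T e ≡ true → wt mu cs S₀ e ≡ wt mu cs T e
    wt-S₀≡wt-T mu {e} e∈ e-special = cong (_+ _) (count-cong _ _ cs same-test)
      where
      same-test : ∀ {d} → d ∈ cs → ((col d ≡ᵇ col e ∸ 1) ∧ (row e ≤ᵇ row d) ∧ (S₀ d <ᵇ S₀ e))
                                 ≡ ((col d ≡ᵇ col e ∸ 1) ∧ (row e ≤ᵇ row d) ∧ (T d <ᵇ T e))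
      same-test {d} d∈ with col d ≡ᵇ col e ∸ 1 in left
      ... | false = refl
      ... | true  = cong ((row e ≤ᵇ row d) ∧_) (bool-ext _ _ S₀<⇒T< T<⇒S₀<)
        where
        S₀<⇒T< : (S₀ d <ᵇ S₀ e) ≡ true → (T d <ᵇ T e) ≡ true
        S₀<⇒T< h = <⇒<ᵇ-true (≤∧≢⇒< (precedes⇒≤ (R<⇒precedes e∈ d∈ (subst₂ _<_ (S₀≡R d∈) (S₀≡R e∈) (<ᵇ-true⇒< _ _ h))))
                                    (proj₂ (special⁻ T e-special) d∈ (≡ᵇ-true⇒≡ _ _ left)))
        T<⇒S₀< : (T d <ᵇ T e) ≡ true → (S₀ d <ᵇ S₀ e) ≡ true
        T<⇒S₀< h = <⇒<ᵇ-true (subst₂ _<_ (sym (S₀≡R d∈)) (sym (S₀≡R e∈)) (R-strict d∈ (inj₁ (<ᵇ-true⇒< _ _ h))))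

-- The two sides

module Expansion (lam mu : List ℕ) (lam-partition : IsPartition lam) (N : ℕ) (R : CommutativeRing 0ℓ 0ℓ)
            (t : CommutativeRing.Carrier R) (x : ℕ → CommutativeRing.Carrier R) where

  cs : List Cell
  cs = cells lam mu

  open SkewDiagram lam mu using (cells-unique; cells-rectangleClosed)
  open Tableaux cs cells-unique (cells-rectangleClosed lam-partition)
  open Sums R
  open CommutativeRing R using (Carrier; _≈_; 0#; setoid)
    renaming ( _*_ to _*R_; refl to ≈-refl; sym to ≈-sym; trans to ≈-trans; reflexive to ≈-reflexive
             ; *-congˡ to *R-congˡ; *-congʳ to *R-congʳ; *-cong to *R-cong )
  open Eval R using (mono; F; HL; RHS; Σ'; Π')
  open import Relation.Binary.Reasoning.Setoid setoid

  Wn WN : List (List ℕ)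
  Wn = words n n
  WN = words n N

  isSSYT isSYT : List ℕ → Bool
  isSSYT vs = semistandard cs (fill cs vs) N
  isSYT s   = semistandard cs (fill cs s) n ∧ isBijection s n

  specials : List ℕ → List Cell
  specials vs = filterᵇ (special cs (fill cs vs)) cs

  weight : List ℕ → List Cell → Carrier
  weight vs = signedPower t (wt mu cs (fill cs vs))

  expandedTerm : List ℕ → Carrier
  expandedTerm vs = ∑ (λ E → weight vs E *R mono x vs) (subsets (specials vs))

  HL≈∑-SSYT : HL lam mu N t x ≈ ∑ (λ vs → when (isSSYT vs) (expandedTerm vs)) WN
  HL≈∑-SSYT = ≈-trans (∑-filterᵇ isSSYT _ WN) (∑-cong WN λ {vs} _ → when-cong (isSSYT vs) λ _ →
    ≈-trans (*R-congʳ (∏-1-pow≈∑-subsets t (wt mu cs (fill cs vs)) (specials vs)))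
            (∑-* (weight vs) (subsets (specials vs)) (mono x vs)))

  F≈∑-compatible : ∀ S E → F (comp n (asc cs S E n)) N x ≈ ∑ (λ w → when (compatibleᵇ S E w) (mono x w)) WN
  F≈∑-compatible S E = ≈-trans
    (≈-reflexive (cong₂ (λ m A → Σ' (map (mono x) (filterᵇ (okF m A) (words m N)))) (sum-comp n A chain) (sub-comp n A chain)))
    (∑-filterᵇ (compatibleᵇ S E) (mono x) WN)
    where
    A : List ℕ
    A = asc cs S E n
    chain : StrictChain 0 A n
    chain = chain-filter (isAscent S E) (oneTo (n ∸ 1)) (chain-oneTo-pred n)
    okF : ℕ → List ℕ → List ℕ → Bool
    okF m A w = all (λ j → at w j ≤ᵇ at w (suc j)) (oneTo (m ∸ 1)) ∧ all (λ j → at w j <ᵇ at w (suc j)) A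

  summand : List ℕ → List Cell → List ℕ → Carrier
  summand s E w = when (isSYT s) (when (compatibleᵇ (fill cs s) E w) (weight s E *R mono x w))

  RHS≈∑-SYT : RHS lam mu N t x ≈ ∑ (λ s → ∑ (λ E → ∑ (summand s E) WN) (subsets (specials s))) Wn
  RHS≈∑-SYT = ≈-trans (∑-filterᵇ isSYT _ Wn) (∑-cong Wn λ {s} _ → ≈-trans
    (when-cong (isSYT s) λ _ → ∑-cong (subsets (specials s)) λ {E} _ →
      ≈-trans (*R-congˡ (F≈∑-compatible (fill cs s) E))
      (≈-trans (*-∑ (weight s E) _ WN) (∑-cong WN λ {w} _ → *-when (compatibleᵇ (fill cs s) E w) (weight s E) (mono x w))))
    (≈-trans (when-∑ (isSYT s) _ (subsets (specials s))) (∑-cong (subsets (specials s)) λ {E} _ → when-∑ (isSYT s) _ WN)))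

  -- A summand of the right-hand side, attached to the filling vs = w ∘ s it destandardises to.
  tagged : List ℕ → List ℕ → List Cell → List ℕ → Carrier
  tagged vs s E w = when (isSYT s) (when (compatibleᵇ (fill cs s) E w) (when (vs == map (at w) s) (weight s E *R mono x w)))

  tagged-zero : ∀ vs s E w → (isSYT s ≡ true → compatibleᵇ (fill cs s) E w ≡ true → (vs == map (at w) s) ≡ true → ⊥) →
                tagged vs s E w ≈ 0#
  tagged-zero vs s E w impossible with isSYT s | compatibleᵇ (fill cs s) E w | vs == map (at w) s
  ... | false | _     | _     = ≈-refl
  ... | true  | false | _     = ≈-refl
  ... | true  | true  | false = ≈-refl
  ... | true  | true  | true  = contradiction refl (impossible refl refl)

  module Summand {s w} (E : List Cell) (s∈ : s ∈ Wn) (w∈ : w ∈ WN) (syt : isSYT s ≡ true)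
                 (compatible : compatibleᵇ (fill cs s) E w ≡ true) where
    syt-parts : semistandard cs (fill cs s) n ≡ true × isBijection s n ≡ true
    syt-parts = ∧-true⁻ syt
    open Standard s (∈-words⁻ n n s∈) (proj₁ syt-parts) (proj₂ syt-parts) public
    open Destandardise w N (∈-words⁻ n N w∈) E (compatibleᵇ⁻ (fill cs s) E w compatible) public

  summand≈∑-tagged : ∀ {s w} E → s ∈ Wn → w ∈ WN → summand s E w ≈ ∑ (λ vs → tagged vs s E w) WN
  summand≈∑-tagged {s} {w} E s∈ w∈ with isSYT s in syt | compatibleᵇ (fill cs s) E w in compatible
  ... | false | _     = ≈-sym (∑-zero WN λ _ → ≈-refl)
  ... | true  | false = ≈-sym (∑-zero WN λ _ → ≈-refl)
  ... | true  | true  = ≈-sym (∑-single (_== map (at w) s) _ WN (count-words n N destandardised-word)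
                          (λ _ tag → ≈-reflexive (cong (λ b → when b _) tag)) (λ _ tag → ≈-reflexive (cong (λ b → when b _) tag)))
    where open Summand E s∈ w∈ syt compatible

  fibre : List ℕ → List ℕ → Carrier
  fibre vs s = ∑ (λ E → ∑ (tagged vs s E) WN) (subsets (specials s))

  RHS≈∑-fibres : RHS lam mu N t x ≈ ∑ (λ vs → ∑ (fibre vs) Wn) WN
  RHS≈∑-fibres = begin
    RHS lam mu N t x
      ≈⟨ RHS≈∑-SYT ⟩
    ∑ (λ s → ∑ (λ E → ∑ (summand s E) WN) (subsets (specials s))) Wn
      ≈⟨ ∑-cong Wn (λ s∈ → ∑-cong (subsets (specials _)) λ {E} _ → ∑-cong WN λ w∈ → summand≈∑-tagged E s∈ w∈) ⟩
    ∑ (λ s → ∑ (λ E → ∑ (λ w → ∑ (λ vs → tagged vs s E w) WN) WN) (subsets (specials s))) Wn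
      ≈⟨ ∑-cong Wn (λ {s} _ → ∑-cong (subsets (specials s)) λ {E} _ → ∑-swap (λ w vs → tagged vs s E w) WN WN) ⟩
    ∑ (λ s → ∑ (λ E → ∑ (λ vs → ∑ (tagged vs s E) WN) WN) (subsets (specials s))) Wn
      ≈⟨ ∑-cong Wn (λ {s} _ → ∑-swap (λ E vs → ∑ (tagged vs s E) WN) (subsets (specials s)) WN) ⟩
    ∑ (λ s → ∑ (λ vs → fibre vs s) WN) Wn
      ≈⟨ ∑-swap (λ s vs → fibre vs s) Wn WN ⟩
    ∑ (λ vs → ∑ (fibre vs) Wn) WN
      ∎

  fibre-nonSSYT : ∀ vs → isSSYT vs ≡ false → ∀ {s} → s ∈ Wn → fibre vs s ≈ 0#
  fibre-nonSSYT vs not-ssyt {s} s∈ = ∑-zero (subsets (specials s)) λ {E} _ → ∑-zero WN λ {w} w∈ →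
    tagged-zero vs s E w λ syt compatible tag → let open Summand E s∈ w∈ syt compatible in
      contradiction (trans (sym (subst (λ z → isSSYT z ≡ true) (sym (==-true⇒≡ vs _ tag)) destandardised-semistandard)) not-ssyt)
                    λ ()

  module SSYTFibre (vs : List ℕ) (vs∈ : vs ∈ WN) (ssyt : isSSYT vs ≡ true) where
    open Standardisation vs N (∈-words⁻ n N vs∈) ssyt

    s₀-SYT : isSYT s₀ ≡ true
    s₀-SYT = ∧-true⁺ s₀-semistandard s₀-bijection

    s₀∈ : s₀ ∈ Wn
    s₀∈ = ∈-words⁺ n n s₀-word

    E-cells : ∀ {E} → E ∈ subsets (specials s₀) → All (λ e → e ∈ cs × 1 < col e) E
    E-cells E∈ = All.map (λ e∈ → let e∈cs , sp = ∈-filterᵇ⁻ (special cs S₀) e∈ in e∈cs , proj₁ (special⁻ S₀ sp))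
                         (∈-subsets⁻ (specials s₀) E∈)

    compatible≡special : ∀ {E} → E ∈ subsets (specials s₀) → compatibleᵇ S₀ E w₀ ≡ all (special cs T) E
    compatible≡special {E} E∈ = bool-ext _ _
      (w₀-compatible⁻ E (E-cells E∈) ∘ compatibleᵇ⁻ S₀ E w₀)
      (compatibleᵇ⁺ S₀ E w₀ ∘ w₀-compatible E (All.map proj₁ (E-cells E∈)))

    weight≈ : ∀ {E} → E ∈ subsets (specials s₀) → all (special cs T) E ≡ true → weight s₀ E ≈ weight vs E
    weight≈ {E} E∈ E-special = ≈-reflexive (signedPower-cong t E λ e∈E →
      wt-S₀≡wt-T mu (proj₁ (All.lookup (E-cells E∈) e∈E)) (all-true⁻ _ E E-special e∈E))

    s₀↭ : s₀ ↭ oneTo n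
    s₀↭ = occursOnce⇒↭-oneTo s₀ S₀.s-letters S₀.s-once

    mono≈ : mono x w₀ ≈ mono x vs
    mono≈ = begin
      Π' (map x w₀)                               ≡⟨ cong (Π' ∘ map x) (sym (map-at-oneTo w₀)) ⟩
      Π' (map x (map (at w₀) (oneTo (length w₀)))) ≡⟨ cong (λ m → Π' (map x (map (at w₀) (oneTo m)))) (proj₁ w₀-word) ⟩
      Π' (map x (map (at w₀) (oneTo n)))          ≈⟨ Π'-↭ (↭-map⁺ x (↭-map⁺ (at w₀) s₀↭)) ⟨
      Π' (map x (map (at w₀) s₀))                 ≡⟨ cong (Π' ∘ map x) w₀∘s₀≡vs ⟩
      Π' (map x vs)                               ∎

    tag-w₀ : (vs == map (at w₀) s₀) ≡ true
    tag-w₀ = subst (λ z → (vs == z) ≡ true) (sym w₀∘s₀≡vs) (==-refl vs)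

    only-w₀ : ∀ {E} → E ∈ subsets (specials s₀) → ∑ (tagged vs s₀ E) WN ≈ when (all (special cs T) E) (weight vs E *R mono x vs)
    only-w₀ {E} E∈ = ∑-single (_== w₀) _ WN (count-words n N w₀-word) on off
      where
      on : ∀ {w} → w ∈ WN → (w == w₀) ≡ true → tagged vs s₀ E w ≈ when (all (special cs T) E) (weight vs E *R mono x vs)
      on {w} _ eq with refl ← ==-true⇒≡ w w₀ eq = ≈-trans
        (≈-reflexive (when-cong³ (weight s₀ E *R mono x w₀) s₀-SYT (compatible≡special E∈) tag-w₀))
        (when-cong (all (special cs T) E) λ E-special → *R-cong (weight≈ E∈ E-special) mono≈)
      off : ∀ {w} → w ∈ WN → (w == w₀) ≡ false → tagged vs s₀ E w ≈ 0#
      off {w} w∈ ne = tagged-zero vs s₀ E w λ syt compatible tag → let open Summand E s₀∈ w∈ syt compatible in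
        contradiction (trans (sym ne) (≡⇒==-true (trans w≡readWord (cong readWord (sym (==-true⇒≡ vs _ tag)))))) λ ()

    fibre-s₀ : fibre vs s₀ ≈ expandedTerm vs
    fibre-s₀ = begin
      fibre vs s₀
        ≈⟨ ∑-cong (subsets (specials s₀)) only-w₀ ⟩
      ∑ (λ E → when (all (special cs T) E) (weight vs E *R mono x vs)) (subsets (specials s₀))
        ≈⟨ ∑-filterᵇ (all (special cs T)) _ (subsets (specials s₀)) ⟨
      ∑ (λ E → weight vs E *R mono x vs) (filterᵇ (all (special cs T)) (subsets (specials s₀)))
        ≡⟨ cong (∑ _) (sym (subsets-filterᵇ (special cs T) (special cs S₀) cs special-T⇒S₀)) ⟩
      expandedTerm vs
        ∎

    fibres≈term : ∑ (fibre vs) Wn ≈ expandedTerm vs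
    fibres≈term = ∑-single (_== s₀) (fibre vs) Wn (count-words n n s₀-word) on off
      where
      on : ∀ {s} → s ∈ Wn → (s == s₀) ≡ true → fibre vs s ≈ expandedTerm vs
      on {s} _ eq with refl ← ==-true⇒≡ s s₀ eq = fibre-s₀
      off : ∀ {s} → s ∈ Wn → (s == s₀) ≡ false → fibre vs s ≈ 0#
      off {s} s∈ ne = ∑-zero (subsets (specials s)) λ {E} _ → ∑-zero WN λ {w} w∈ →
        tagged-zero vs s E w λ syt compatible tag → let open Summand E s∈ w∈ syt compatible in
          contradiction (trans (sym ne) (≡⇒==-true (trans s≡standardisation (cong standardisation (sym (==-true⇒≡ vs _ tag))))))
                        λ ()

  fibres≈when : ∀ {vs} → vs ∈ WN → ∑ (fibre vs) Wn ≈ when (isSSYT vs) (expandedTerm vs)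
  fibres≈when {vs} vs∈ with isSSYT vs in ssyt
  ... | true  = SSYTFibre.fibres≈term vs vs∈ ssyt
  ... | false = ∑-zero Wn (fibre-nonSSYT vs ssyt)

  HL≈RHS : HL lam mu N t x ≈ RHS lam mu N t x
  HL≈RHS = ≈-trans HL≈∑-SSYT (≈-trans (≈-sym (∑-cong WN fibres≈when)) (≈-sym RHS≈∑-fibres))

theorem4p1 : (lam mu : List ℕ) → IsPartition lam → IsPartition mu → mu ⊆ₚ lam →
    (N : ℕ) → length (cells lam mu) ≤ N →
    (R : CommutativeRing 0ℓ 0ℓ) → (t : CommutativeRing.Carrier R) → (x : ℕ → CommutativeRing.Carrier R) →
    CommutativeRing._≈_ R (Eval.HL R lam mu N t x) (Eval.RHS R lam mu N t x)
theorem4p1 lam mu lam-partition _ _ N _ R t x = Expansion.HL≈RHS lam mu lam-partition N R t x
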